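{- Let $\delta_0>0$. Let $k\ge 2$ and $\delta\in[\delta_0,1)$ with $\delta k+k-1$ an odd integer, let $P(x)=\operatorname{sign}(\delta k x_1+x_2+\cdots+x_k)$, $u=\frac{1+\delta}{2}k$, $v=\frac{1-\delta}{2}k$. Then $\hat P_P=1-\frac{1}{2^{k-2}}\sum_{l=0}^{v-1}\binom{k-1}{l}$, and for every fixed positive integer $t$ there is a constant $K_t$ (depending on $t$ but not on $\delta$ or $k$) such that: if $t$ is odd and $t\le k-1$, \[ \hat P_{tC}=\frac{1}{2^{k-2}}\cdot\frac{(k-t-1)!}{(u-1)!(v-1)!}\Big(\delta^{t-1}k^{t-1}-\frac{(t-1)(t-2)}{2}\delta^{t-3}k^{t-2}+R\Big), \] and if $t$ is even and $t\le k-1$, \[ \hat P_{P+tC}=-\frac{1}{2^{k-2}}\cdot\frac{(k-t-1)!}{(u-1)!(v-1)!}\Big(\delta^{t-1}k^{t-1}-\frac{(t-1)(t-2)}{2}\delta^{t-3}k^{t-2}+R\Big), \] where in each case $|R|\le K_t k^{t-3}$.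
   Context: $\hat P_I=\mathbb{E}_x[P(x)\prod_{i\in I}x_i]$ for $x$ uniform on $\{ -1,1\}^k$. Index $1$ is the president, indices $2,\dots,k$ the citizens; $\hat P_P=\hat P_{\{1\}}$, $\hat P_{tC}$ is $\hat P_I$ for $I$ a set of $t$ citizens, and $\hat P_{P+tC}$ is $\hat P_I$ for $I$ the president together with $t$ citizens. (Under the hypotheses $u,v$ are positive integers.) -}

module Defs where

open import Data.Bool using (Bool; true; false; if_then_else_)
open import Data.Nat as ℕ using (ℕ; zero; suc)
open import Data.Integer as ℤ using (ℤ; +_; +[1+_]; -[1+_])
open import Data.Rational as ℚ using (ℚ; mkℚ; 0ℚ; 1ℚ; _+_; _*_; _-_; -_; 1/_; _≤ᵇ_)
open import Data.Vec using (Vec; []; _∷_)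
open import Data.List using (List; []; _∷_; map; _++_)
open import Data.Fin.Subset using (Subset; Side; inside; outside)

ℕ→ℚ : ℕ → ℚ
ℕ→ℚ n = + n ℚ./ 1

ℤ→ℚ : ℤ → ℚ
ℤ→ℚ z = z ℚ./ 1

IsOddInteger : ℚ → Set
IsOddInteger q = Σ ℤ λ n → q ≡ ℤ→ℚ ((+ 2) ℤ.* n ℤ.+ (+ 1))
  where open import Data.Product using (Σ)
        open import Relation.Binary.PropositionalEquality using (_≡_)

_^ℕ_ : ℚ → ℕ → ℚ
q ^ℕ zero = 1ℚ
q ^ℕ suc n = q * (q ^ℕ n)

-- multiplicative inverse (only ever applied to nonzero arguments here; 0 ↦ 0)
inv : ℚ → ℚ
inv (mkℚ (+ zero) _ _) = 0ℚ
inv q@(mkℚ +[1+ _ ] _ _) = 1/ q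
inv q@(mkℚ -[1+ _ ] _ _) = 1/ q

_^ℤ_ : ℚ → ℤ → ℚ
q ^ℤ (+ n) = q ^ℕ n
q ^ℤ -[1+ n ] = inv q ^ℕ suc n

sign : ℚ → ℚ
sign q = if q ≤ᵇ 0ℚ then (if 0ℚ ≤ᵇ q then 0ℚ else - 1ℚ) else 1ℚ

-- points of the hypercube {-1,1}^k : true ↦ 1, false ↦ -1
val : Bool → ℚ
val true = 1ℚ
val false = - 1ℚ

allPoints : (k : ℕ) → List (Vec Bool k)
allPoints zero = [] ∷ []
allPoints (suc k) = map (true ∷_) (allPoints k) ++ map (false ∷_) (allPoints k)

sumVals : ∀ {n} → Vec Bool n → ℚ
sumVals [] = 0ℚ
sumVals (b ∷ bs) = val b + sumVals bs

-- the linear form  (δk) x₁ + x₂ + ⋯ + x_k  (first coordinate = president)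
linForm : ℚ → ∀ {k} → Vec Bool k → ℚ
linForm c [] = 0ℚ
linForm c (b ∷ bs) = c * val b + sumVals bs

P : ℚ → (k : ℕ) → Vec Bool k → ℚ
P δ k x = sign (linForm (δ * ℕ→ℚ k) x)

χ : ∀ {k} → Subset k → Vec Bool k → ℚ
χ [] [] = 1ℚ
χ (inside ∷ I) (b ∷ x) = val b * χ I x
χ (outside ∷ I) (b ∷ x) = χ I x

sumℚ : List ℚ → ℚ
sumℚ [] = 0ℚ
sumℚ (q ∷ qs) = q + sumℚ qs

fourier : (k : ℕ) → (Vec Bool k → ℚ) → Subset k → ℚ
fourier k f I = inv (ℕ→ℚ (2 ℕ.^ k)) * sumℚ (map (λ x → f x * χ I x) (allPoints k))

Σ< : ℕ → (ℕ → ℚ) → ℚ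
Σ< zero f = 0ℚ
Σ< (suc n) f = Σ< n f + f n

-- the president (index 1, the first coordinate) is not / is in I
NoPresident : ∀ {k} → Subset k → Set
NoPresident [] = ⊤
  where open import Data.Unit using (⊤)
NoPresident (s ∷ _) = s ≡ outside
  where open import Relation.Binary.PropositionalEquality using (_≡_)

HasPresident : ∀ {k} → Subset k → Set
HasPresident [] = ⊥
  where open import Data.Empty using (⊥)
HasPresident (s ∷ _) = s ≡ inside
  where open import Relation.Binary.PropositionalEquality using (_≡_)

mainTerm : ℚ → ℕ → ℕ → ℚ
mainTerm δ k t =
  (δ ^ℤ (+ t ℤ.- + 1)) * (ℕ→ℚ k ^ℤ (+ t ℤ.- + 1))
  - (ℤ→ℚ ((+ t ℤ.- + 1) ℤ.* (+ t ℤ.- + 2)) * ℚ.½)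
    * (δ ^ℤ (+ t ℤ.- + 3)) * (ℕ→ℚ k ^ℤ (+ t ℤ.- + 2))

prefactor : ℕ → ℕ → ℕ → ℕ → ℚ
prefactor k t u v =
  inv (ℕ→ℚ (2 ℕ.^ (k ℕ.∸ 2)))
  * (ℕ→ℚ ((k ℕ.∸ t ℕ.∸ 1) ℕ.!) * inv (ℕ→ℚ (((u ℕ.∸ 1) ℕ.!) ℕ.* ((v ℕ.∸ 1) ℕ.!))))

module Submission where

-- From u + v = k and u - v = δk, the president's weight c = δk is an integer.  Summing out the
-- president's coordinate writes the coefficient at I = {president?} ∪ J as 2^{-k} (corr(c, J) ± corr(-c, J)),
--     corr(c, J) = Σ_{y ∈ {-1,1}^{k-1}} sgn(c + y₁ + ⋯ + y_{k-1}) χ_J(y),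
-- and the symmetry y ↦ -y gives corr(-c, J) = -(-1)^{|J|} corr(c, J); in each case of the lemma the two
-- terms agree and the coefficient is 2^{-k} · 2 corr(c, J).
--
-- Splitting off a coordinate shifts the threshold c by ±1.
--     This gives the counting formula for J = ∅ (the president's coefficient) and, by induction on J, the
--     exact identity α! β! corr(α - β, J) = (-1)ⁿ 2 r! Qₙ(α, β) for |J| = n + 1, where u = α + 1,
--     v = β + 1, r = k - |J| - 1 and Q₀ = 1, Q_{n+1}(a,b) = a Qₙ(a-1,b) - b Qₙ(a,b-1).
--   ErrorBound: Q_{p+2}(a,b) = (a-b)^{p+2} - C(p+2,2) (a-b)^p (a+b+2) + O((a+b+2)^p) with a constant
--     depending only on p, by induction on p using Taylor estimates for (c ± 1)ⁿ.

module SignSums where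

  open import Data.Bool using (Bool; true; false)
  open import Data.Nat as ℕ using (ℕ; zero; suc; _!; _^_)
  open import Data.Nat.Combinatorics using (_C_; nCk+nC[k+1]≡[n+1]C[k+1]; nCk≡n!/k![n-k]!; k![n∸k]!∣n!; k>n⇒nCk≡0)
  open import Data.Nat.DivMod using (m/n*n≡m)
  open import Data.Integer as ℤ using (ℤ; +_; -[1+_]; +[1+_]; _+_; _*_; -_; _-_)
  import Data.Integer.Properties as ℤP
  import Data.Nat.Properties as ℕP
  open import Data.Integer.Solver using (module +-*-Solver)
  import Data.Nat.Solver as ℕSolver
  open import Data.Vec using (Vec; []; _∷_)
  open import Data.List using (List; []; _∷_; map; _++_)
  open import Data.Fin.Subset using (Subset; Side; inside; outside; ∣_∣)
  open import Data.Fin.Subset.Properties using (∣p∣≤n)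
  open import Data.Empty using (⊥-elim)
  open import Function using (_∘_)
  open import Relation.Binary.PropositionalEquality
  open import Defs using (allPoints)
  open import Algebra.Properties.CommutativeSemigroup ℕP.*-commutativeSemigroup using (x∙yz≈y∙xz)

  open +-*-Solver using (solve; _:+_; _:*_; _:-_; :-_; con; _:=_)
  open ≡-Reasoning

  spin : Bool → ℤ
  spin true = + 1
  spin false = -[1+ 0 ]

  spinSum : ∀ {n} → Vec Bool n → ℤ
  spinSum [] = + 0
  spinSum (b ∷ x) = spin b + spinSum x

  character : ∀ {n} → Subset n → Vec Bool n → ℤ
  character [] [] = + 1
  character (inside ∷ I) (b ∷ x) = spin b * character I x
  character (outside ∷ I) (b ∷ x) = character I x

  signum : ℤ → ℤ
  signum (+ zero) = + 0
  signum +[1+ _ ] = + 1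
  signum -[1+ _ ] = -[1+ 0 ]

  linearForm : ℤ → ∀ {k} → Vec Bool k → ℤ
  linearForm c [] = + 0
  linearForm c (b ∷ x) = c * spin b + spinSum x

  sumOver : ∀ {A : Set} → (A → ℤ) → List A → ℤ
  sumOver f [] = + 0
  sumOver f (x ∷ xs) = f x + sumOver f xs

  sumOver-++ : ∀ {A : Set} (f : A → ℤ) xs ys → sumOver f (xs ++ ys) ≡ sumOver f xs + sumOver f ys
  sumOver-++ f [] ys = sym (ℤP.+-identityˡ _)
  sumOver-++ f (x ∷ xs) ys = trans (cong (λ z → f x + z) (sumOver-++ f xs ys)) (sym (ℤP.+-assoc (f x) _ _))

  sumOver-map : ∀ {A B : Set} (f : B → ℤ) (g : A → B) xs → sumOver f (map g xs) ≡ sumOver (f ∘ g) xs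
  sumOver-map f g [] = refl
  sumOver-map f g (x ∷ xs) = cong (λ z → f (g x) + z) (sumOver-map f g xs)

  sumOver-cong : ∀ {A : Set} {f g : A → ℤ} → (∀ x → f x ≡ g x) → ∀ xs → sumOver f xs ≡ sumOver g xs
  sumOver-cong f≗g [] = refl
  sumOver-cong f≗g (x ∷ xs) = cong₂ _+_ (f≗g x) (sumOver-cong f≗g xs)

  sumOver-neg : ∀ {A : Set} (f : A → ℤ) xs → sumOver (λ x → - f x) xs ≡ - sumOver f xs
  sumOver-neg f [] = refl
  sumOver-neg f (x ∷ xs) = trans (cong (λ z → - f x + z) (sumOver-neg f xs)) (sym (ℤP.neg-distrib-+ (f x) _))

  cube-split : ∀ {n} (f : Vec Bool (suc n) → ℤ) →
    sumOver f (allPoints (suc n)) ≡ sumOver (f ∘ (true ∷_)) (allPoints n) + sumOver (f ∘ (false ∷_)) (allPoints n)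
  cube-split {n} f = trans (sumOver-++ f (map (true ∷_) (allPoints n)) _)
    (cong₂ _+_ (sumOver-map f _ (allPoints n)) (sumOver-map f _ (allPoints n)))

  corr : ∀ {m} → ℤ → Subset m → ℤ
  corr {m} c I = sumOver (λ y → signum (c + spinSum y) * character I y) (allPoints m)

  corr-nil : ∀ c → corr c [] ≡ signum c
  corr-nil c = trans (ℤP.+-identityʳ _) (trans (ℤP.*-identityʳ _) (cong signum (ℤP.+-identityʳ c)))

  corr-inside : ∀ {m} c (I : Subset m) → corr c (inside ∷ I) ≡ corr (c + + 1) I - corr (c - + 1) I
  corr-inside {m} c I = trans (cube-split (λ y → signum (c + spinSum y) * character (inside ∷ I) y)) (cong₂ _+_
    (sumOver-cong (λ y → cong₂ _*_ (cong signum (sym (ℤP.+-assoc c (+ 1) (spinSum y)))) (ℤP.*-identityˡ _)) (allPoints m))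
    (trans (sumOver-cong (λ y → trans (cong₂ _*_ (cong signum (sym (ℤP.+-assoc c -[1+ 0 ] (spinSum y)))) (ℤP.-1*i≡-i _))
                                      (sym (ℤP.neg-distribʳ-* (signum (c - + 1 + spinSum y)) (character I y)))) (allPoints m))
           (sumOver-neg (λ y → signum (c - + 1 + spinSum y) * character I y) (allPoints m))))

  corr-outside : ∀ {m} c (I : Subset m) → corr c (outside ∷ I) ≡ corr (c + + 1) I + corr (c - + 1) I
  corr-outside {m} c I = trans (cube-split (λ y → signum (c + spinSum y) * character (outside ∷ I) y)) (cong₂ _+_
    (sumOver-cong (λ y → cong (_* character I y) (cong signum (sym (ℤP.+-assoc c (+ 1) (spinSum y))))) (allPoints m))
    (sumOver-cong (λ y → cong (_* character I y) (cong signum (sym (ℤP.+-assoc c -[1+ 0 ] (spinSum y))))) (allPoints m)))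

  parity : ℕ → ℤ
  parity zero = + 1
  parity (suc n) = - parity n

  parity-even : ∀ h → parity (2 ℕ.* h) ≡ + 1
  parity-even zero = refl
  parity-even (suc h) = trans (cong parity (cong suc (ℕP.+-suc h (h ℕ.+ 0))))
                              (trans (ℤP.neg-involutive (parity (2 ℕ.* h))) (parity-even h))

  parity-odd : ∀ h → parity (2 ℕ.* h ℕ.+ 1) ≡ -[1+ 0 ]
  parity-odd h = trans (cong parity (ℕP.+-comm (2 ℕ.* h) 1)) (cong -_ (parity-even h))

  signum-neg : ∀ c → signum (- c) ≡ - signum c
  signum-neg (+ zero) = refl
  signum-neg +[1+ n ] = refl
  signum-neg -[1+ n ] = refl

  neg-up : ∀ c → - c + + 1 ≡ - (c - + 1)
  neg-up = solve 1 (λ c → :- c :+ con (+ 1) := :- (c :- con (+ 1))) refl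

  neg-down : ∀ c → - c - + 1 ≡ - (c + + 1)
  neg-down = solve 1 (λ c → :- c :- con (+ 1) := :- (c :+ con (+ 1))) refl

  -- Symmetry y ↦ -y: corr(-c, I) = -(-1)^|I| corr(c, I).
  corr-neg : ∀ {m} (I : Subset m) c → corr (- c) I ≡ - (parity ∣ I ∣ * corr c I)
  corr-neg [] c = begin
    corr (- c) []            ≡⟨ corr-nil (- c) ⟩
    signum (- c)             ≡⟨ signum-neg c ⟩
    - signum c               ≡⟨ cong -_ (sym (ℤP.*-identityˡ (signum c))) ⟩
    - (+ 1 * signum c)       ≡⟨ cong (λ z → - (+ 1 * z)) (sym (corr-nil c)) ⟩
    - (+ 1 * corr c [])      ∎
  corr-neg (outside ∷ I) c = begin
    corr (- c) (outside ∷ I)                       ≡⟨ corr-outside (- c) I ⟩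
    corr (- c + + 1) I + corr (- c - + 1) I        ≡⟨ cong₂ (λ x y → corr x I + corr y I) (neg-up c) (neg-down c) ⟩
    corr (- (c - + 1)) I + corr (- (c + + 1)) I    ≡⟨ cong₂ _+_ (corr-neg I (c - + 1)) (corr-neg I (c + + 1)) ⟩
    - (s * corr (c - + 1) I) + - (s * corr (c + + 1) I)
      ≡⟨ solve 3 (λ s x y → :- (s :* x) :+ :- (s :* y) := :- (s :* (y :+ x))) refl s (corr (c - + 1) I) (corr (c + + 1) I) ⟩
    - (s * (corr (c + + 1) I + corr (c - + 1) I))  ≡⟨ cong (λ z → - (s * z)) (sym (corr-outside c I)) ⟩
    - (s * corr c (outside ∷ I))                   ∎
    where s = parity ∣ I ∣
  corr-neg (inside ∷ I) c = begin
    corr (- c) (inside ∷ I)                        ≡⟨ corr-inside (- c) I ⟩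
    corr (- c + + 1) I - corr (- c - + 1) I        ≡⟨ cong₂ (λ x y → corr x I - corr y I) (neg-up c) (neg-down c) ⟩
    corr (- (c - + 1)) I - corr (- (c + + 1)) I    ≡⟨ cong₂ _-_ (corr-neg I (c - + 1)) (corr-neg I (c + + 1)) ⟩
    - (s * corr (c - + 1) I) - - (s * corr (c + + 1) I)
      ≡⟨ solve 3 (λ s x y → :- (s :* x) :- :- (s :* y) := :- ((:- s) :* (y :- x))) refl s (corr (c - + 1) I) (corr (c + + 1) I) ⟩
    - (- s * (corr (c + + 1) I - corr (c - + 1) I)) ≡⟨ cong (λ z → - (- s * z)) (sym (corr-inside c I)) ⟩
    - (- s * corr c (inside ∷ I))                  ∎
    where s = parity ∣ I ∣

  -- The value of Σ_y χ_I(y) through its recurrence: 2ᵐ for I = ∅ and 0 otherwise.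
  charSum : ∀ {m} → Subset m → ℤ
  charSum [] = + 1
  charSum (inside ∷ I) = + 0
  charSum (outside ∷ I) = charSum I + charSum I

  charSum-empty : ∀ {m} (I : Subset m) → ∣ I ∣ ≡ 0 → charSum I ≡ + (2 ^ m)
  charSum-empty [] _ = refl
  charSum-empty {suc m} (outside ∷ I) ∣I∣≡0 = begin
    charSum I + charSum I          ≡⟨ cong₂ _+_ (charSum-empty I ∣I∣≡0) (charSum-empty I ∣I∣≡0) ⟩
    + (2 ^ m) + + (2 ^ m)          ≡⟨ sym (ℤP.pos-+ (2 ^ m) (2 ^ m)) ⟩
    + (2 ^ m ℕ.+ 2 ^ m)            ≡⟨ cong (λ z → + (2 ^ m ℕ.+ z)) (sym (ℕP.+-identityʳ (2 ^ m))) ⟩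
    + (2 ^ suc m)                  ∎

  charSum-nonempty : ∀ {m} (I : Subset m) t → ∣ I ∣ ≡ suc t → charSum I ≡ + 0
  charSum-nonempty (inside ∷ I) t _ = refl
  charSum-nonempty (outside ∷ I) t ∣I∣≡1+t = cong₂ _+_ (charSum-nonempty I t ∣I∣≡1+t) (charSum-nonempty I t ∣I∣≡1+t)

  pos-suc : ∀ n → + n + + 1 ≡ + suc n
  pos-suc n = trans (sym (ℤP.pos-+ n 1)) (cong +_ (ℕP.+-comm n 1))

  above-up : ∀ m j → + (suc m ℕ.+ suc j) + + 1 ≡ + (m ℕ.+ suc (suc (suc j)))
  above-up m j = trans (pos-suc (suc m ℕ.+ suc j))
    (cong +_ (sym (trans (ℕP.+-suc m (suc (suc j))) (cong suc (ℕP.+-suc m (suc j))))))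

  -- Saturation: for c > m the sign is constantly 1, so corr c I = Σ_y χ_I(y).
  corr-above : ∀ {m} (I : Subset m) j → corr (+ (m ℕ.+ suc j)) I ≡ charSum I
  corr-above [] j = corr-nil (+ suc j)
  corr-above {suc m} (inside ∷ I) j = begin
    corr c (inside ∷ I)                  ≡⟨ corr-inside c I ⟩
    corr (c + + 1) I - corr (c - + 1) I  ≡⟨ cong₂ _-_ (trans (cong (λ z → corr z I) (above-up m j)) (corr-above I (suc (suc j)))) (corr-above I j) ⟩
    charSum I - charSum I                ≡⟨ ℤP.+-inverseʳ (charSum I) ⟩
    + 0                                  ∎
    where c = + (suc m ℕ.+ suc j)
  corr-above {suc m} (outside ∷ I) j = trans (corr-outside (+ (suc m ℕ.+ suc j)) I) (
    cong₂ _+_ (trans (cong (λ z → corr z I) (above-up m j)) (corr-above I (suc (suc j)))) (corr-above I j))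

  -- For c < -m the sign is constantly -1; by symmetry corr c I = -(-1)^|I| Σ_y χ_I(y).
  corr-below : ∀ {m} (I : Subset m) j → corr (-[1+ m ℕ.+ j ]) I ≡ - (parity ∣ I ∣ * charSum I)
  corr-below {m} I j = begin
    corr (-[1+ m ℕ.+ j ]) I                    ≡⟨ cong (λ z → corr (- + z) I) (sym (ℕP.+-suc m j)) ⟩
    corr (- + (m ℕ.+ suc j)) I                 ≡⟨ corr-neg I (+ (m ℕ.+ suc j)) ⟩
    - (parity ∣ I ∣ * corr (+ (m ℕ.+ suc j)) I) ≡⟨ cong (λ z → - (parity ∣ I ∣ * z)) (corr-above I j) ⟩
    - (parity ∣ I ∣ * charSum I)                ∎

  -- binomialPrefix m v = Σ_{l<v} C(m,l), the number of y ∈ {-1,1}ᵐ with fewer than v coordinates -1.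
  binomialPrefix : ℕ → ℕ → ℕ
  binomialPrefix m zero = 0
  binomialPrefix m (suc v) = binomialPrefix m v ℕ.+ m C v

  binomialPrefix-pascal : ∀ m v → binomialPrefix (suc m) (suc v) ≡ binomialPrefix m (suc v) ℕ.+ binomialPrefix m v
  binomialPrefix-pascal m zero = refl
  binomialPrefix-pascal m (suc v) = begin
    binomialPrefix (suc m) (suc v) ℕ.+ suc m C suc v
      ≡⟨ cong₂ ℕ._+_ (binomialPrefix-pascal m v) (sym (nCk+nC[k+1]≡[n+1]C[k+1] m v)) ⟩
    (A ℕ.+ B) ℕ.+ (m C v ℕ.+ m C suc v)
      ≡⟨ ℕS.solve 4 (λ A B x y → (A ℕS.:+ B) ℕS.:+ (x ℕS.:+ y) ℕS.:= (A ℕS.:+ y) ℕS.:+ (B ℕS.:+ x)) refl A B (m C v) (m C suc v) ⟩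
    (A ℕ.+ m C suc v) ℕ.+ (B ℕ.+ m C v) ∎
    where module ℕS = ℕSolver.+-*-Solver
          A = binomialPrefix m (suc v)
          B = binomialPrefix m v

  binomialPrefix-full : ∀ m → binomialPrefix m (suc m) ≡ 2 ^ m
  binomialPrefix-full zero = refl
  binomialPrefix-full (suc m) = begin
    binomialPrefix (suc m) (suc (suc m))                          ≡⟨ binomialPrefix-pascal m (suc m) ⟩
    (binomialPrefix m (suc m) ℕ.+ m C suc m) ℕ.+ binomialPrefix m (suc m)
      ≡⟨ cong₂ (λ x y → (x ℕ.+ y) ℕ.+ x) (binomialPrefix-full m) (k>n⇒nCk≡0 (ℕP.n<1+n m)) ⟩
    (2 ^ m ℕ.+ 0) ℕ.+ 2 ^ m                                       ≡⟨ cong (ℕ._+ 2 ^ m) (ℕP.+-identityʳ (2 ^ m)) ⟩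
    2 ^ m ℕ.+ 2 ^ m                                               ≡⟨ cong (2 ^ m ℕ.+_) (sym (ℕP.+-identityʳ (2 ^ m))) ⟩
    2 ^ suc m                                                     ∎

  shift-up : ∀ a b → + a - + suc b + + 1 ≡ + a - + b
  shift-up a b = solve 2 (λ A B → A :- (con (+ 1) :+ B) :+ con (+ 1) := A :- B) refl (+ a) (+ b)

  shift-down : ∀ a b → + suc a - + b - + 1 ≡ + a - + b
  shift-down a b = solve 2 (λ A B → (con (+ 1) :+ A) :- B :- con (+ 1) := A :- B) refl (+ a) (+ b)

  threshold-up : ∀ a b → + a - + b + + 1 ≡ + suc a - + b
  threshold-up a b = solve 2 (λ A B → A :- B :+ con (+ 1) := (con (+ 1) :+ A) :- B) refl (+ a) (+ b)

  threshold-down : ∀ a b → + a - + b - + 1 ≡ + a - + suc b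
  threshold-down a b = solve 2 (λ A B → A :- B :- con (+ 1) := A :- (con (+ 1) :+ B)) refl (+ a) (+ b)

  -- Counting formula: for I = ∅ and u + v = m + 1, corr(u - v, ∅) = 2ᵐ - 2 Σ_{l<v} C(m,l),
  -- since sgn(u - v + Σy) = -1 exactly when y has at least u minus-coordinates.
  corr-empty : ∀ {m} (I : Subset m) u v → ∣ I ∣ ≡ 0 → u ℕ.+ v ≡ suc m →
    corr (+ u - + v) I ≡ + (2 ^ m) - + 2 * + binomialPrefix m v
  corr-empty {m} I u zero ∣I∣≡0 u+0≡1+m with trans (sym (ℕP.+-identityʳ u)) u+0≡1+m
  ... | refl = begin
    corr (+ suc m - + 0) I            ≡⟨ cong (λ z → corr z I) (trans (ℤP.+-identityʳ (+ suc m)) (cong +_ (ℕP.+-comm 1 m))) ⟩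
    corr (+ (m ℕ.+ suc 0)) I          ≡⟨ corr-above I 0 ⟩
    charSum I                         ≡⟨ charSum-empty I ∣I∣≡0 ⟩
    + (2 ^ m)                         ≡⟨ sym (ℤP.+-identityʳ (+ (2 ^ m))) ⟩
    + (2 ^ m) - + 2 * + 0             ∎
  corr-empty {m} I zero (suc m) ∣I∣≡0 refl = begin
    corr (-[1+ m ]) I                 ≡⟨ cong (λ z → corr (-[1+ z ]) I) (sym (ℕP.+-identityʳ m)) ⟩
    corr (-[1+ m ℕ.+ 0 ]) I           ≡⟨ corr-below I 0 ⟩
    - (parity ∣ I ∣ * charSum I)      ≡⟨ cong₂ (λ p q → - (parity p * q)) ∣I∣≡0 (charSum-empty I ∣I∣≡0) ⟩
    - (+ 1 * + (2 ^ m))               ≡⟨ solve 1 (λ X → :- (con (+ 1) :* X) := X :- con (+ 2) :* X) refl (+ (2 ^ m)) ⟩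
    + (2 ^ m) - + 2 * + (2 ^ m)       ≡⟨ cong (λ z → + (2 ^ m) - + 2 * + z) (sym (binomialPrefix-full m)) ⟩
    + (2 ^ m) - + 2 * + binomialPrefix m (suc m) ∎
  corr-empty {zero} [] (suc u) (suc v) _ u+v≡1 with trans (sym (ℕP.+-suc (suc u) v)) u+v≡1
  ... | ()
  corr-empty {suc m} (outside ∷ I) (suc u) (suc v) ∣I∣≡0 u+v≡m = begin
    corr (+ suc u - + suc v) (outside ∷ I)                             ≡⟨ corr-outside (+ suc u - + suc v) I ⟩
    corr (+ suc u - + suc v + + 1) I + corr (+ suc u - + suc v - + 1) I
      ≡⟨ cong₂ (λ x y → corr x I + corr y I) (shift-up (suc u) v) (shift-down u (suc v)) ⟩
    corr (+ suc u - + v) I + corr (+ u - + suc v) I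
      ≡⟨ cong₂ _+_ (corr-empty I (suc u) v ∣I∣≡0 (ℕP.suc-injective (trans (sym (ℕP.+-suc (suc u) v)) u+v≡m)))
                   (corr-empty I u (suc v) ∣I∣≡0 (ℕP.suc-injective u+v≡m)) ⟩
    (X - + 2 * + B) + (X - + 2 * + A)
      ≡⟨ solve 3 (λ X A B → (X :- con (+ 2) :* B) :+ (X :- con (+ 2) :* A) := (X :+ X) :- con (+ 2) :* (A :+ B)) refl X (+ A) (+ B) ⟩
    (X + X) - + 2 * (+ A + + B)
      ≡⟨ cong₂ (λ x y → x - + 2 * y) (sym (ℤP.pos-+ (2 ^ m) (2 ^ m))) (sym (ℤP.pos-+ A B)) ⟩
    + (2 ^ m ℕ.+ 2 ^ m) - + 2 * + (A ℕ.+ B)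
      ≡⟨ cong₂ (λ x y → + x - + 2 * + y) (cong (2 ^ m ℕ.+_) (sym (ℕP.+-identityʳ (2 ^ m)))) (sym (binomialPrefix-pascal m v)) ⟩
    + (2 ^ suc m) - + 2 * + binomialPrefix (suc m) (suc v) ∎
    where X = + (2 ^ m)
          A = binomialPrefix m (suc v)
          B = binomialPrefix m v

  choose-mul-factorials : ∀ a b → ((a ℕ.+ b) C b) ℕ.* (b ! ℕ.* a !) ≡ (a ℕ.+ b) !
  choose-mul-factorials a b = begin
    ((a ℕ.+ b) C b) ℕ.* (b ! ℕ.* a !)              ≡⟨ cong (λ d → ((a ℕ.+ b) C b) ℕ.* (b ! ℕ.* d !)) (sym (ℕP.m+n∸n≡m a b)) ⟩
    ((a ℕ.+ b) C b) ℕ.* (b ! ℕ.* (a ℕ.+ b ℕ.∸ b) !) ≡⟨ cong (ℕ._* (b ! ℕ.* (a ℕ.+ b ℕ.∸ b) !)) (nCk≡n!/k![n-k]! b≤a+b) ⟩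
    _                                             ≡⟨ m/n*n≡m {{ℕP._!*_!≢0 b (a ℕ.+ b ℕ.∸ b)}} (k![n∸k]!∣n! b≤a+b) ⟩
    (a ℕ.+ b) !                                   ∎
    where b≤a+b = ℕP.m≤n+m b a

  weighted : ∀ {m} → Subset m → ℕ → ℕ → ℤ
  weighted I α β = + (α ! ℕ.* β !) * corr (+ α - + β) I

  -- One citizen: the difference of two counting formulas is 2 C(α+β, β).
  weighted-singleton : ∀ {m} (I : Subset m) α β → ∣ I ∣ ≡ 0 → m ≡ α ℕ.+ β →
    weighted (inside ∷ I) α β ≡ + 2 * + ((α ℕ.+ β) !)
  weighted-singleton I α β ∣I∣≡0 refl = begin
    + F * corr (+ α - + β) (inside ∷ I)                       ≡⟨ cong (+ F *_) (corr-inside (+ α - + β) I) ⟩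
    + F * (corr (+ α - + β + + 1) I - corr (+ α - + β - + 1) I)
      ≡⟨ cong (λ z → + F * z) (cong₂ (λ x y → corr x I - corr y I) (threshold-up α β) (threshold-down α β)) ⟩
    + F * (corr (+ suc α - + β) I - corr (+ α - + suc β) I)
      ≡⟨ cong (λ z → + F * z) (cong₂ _-_ (corr-empty I (suc α) β ∣I∣≡0 refl) (corr-empty I α (suc β) ∣I∣≡0 (ℕP.+-suc α β))) ⟩
    + F * ((X - + 2 * + S) - (X - + 2 * + (S ℕ.+ N)))          ≡⟨ cong (λ z → + F * ((X - + 2 * + S) - (X - + 2 * z))) (ℤP.pos-+ S N) ⟩
    + F * ((X - + 2 * + S) - (X - + 2 * (+ S + + N)))
      ≡⟨ solve 4 (λ F X S N → F :* ((X :- con (+ 2) :* S) :- (X :- con (+ 2) :* (S :+ N))) := con (+ 2) :* (N :* F)) refl (+ F) X (+ S) (+ N) ⟩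
    + 2 * (+ N * + F)                                         ≡⟨ cong (+ 2 *_) (sym (ℤP.pos-* N F)) ⟩
    + 2 * + (N ℕ.* F)                                         ≡⟨ cong (λ z → + 2 * + (N ℕ.* z)) (ℕP.*-comm (α !) (β !)) ⟩
    + 2 * + (N ℕ.* (β ! ℕ.* α !))                              ≡⟨ cong (λ z → + 2 * + z) (choose-mul-factorials α β) ⟩
    + 2 * + ((α ℕ.+ β) !)                                     ∎
    where F = α ! ℕ.* β !
          X = + (2 ^ (α ℕ.+ β))
          S = binomialPrefix (α ℕ.+ β) β
          N = (α ℕ.+ β) C β

  Q : ℕ → ℤ → ℤ → ℤ
  Q zero a b = + 1
  Q (suc n) a b = a * Q n (a - + 1) b - b * Q n a (b - + 1)

  -- b Qₙ(a,b-1) + a Qₙ(a-1,b) = (a + b - n) Qₙ(a,b): the identity that closes the recursion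
  -- when the first coordinate is not in I.
  Q-balance : ∀ n a b → b * Q n a (b - + 1) + a * Q n (a - + 1) b ≡ (a + b - + n) * Q n a b
  Q-balance zero a b = solve 2 (λ a b → b :* con (+ 1) :+ a :* con (+ 1) := (a :+ b :- con (+ 0)) :* con (+ 1)) refl a b
  Q-balance (suc n) a b = begin
    b * (a * X₁ - (b - + 1) * X₂) + a * ((a - + 1) * X₃ - b * X₁)
      ≡⟨ solve 5 (λ a b X₁ X₂ X₃ → b :* (a :* X₁ :- (b :- con (+ 1)) :* X₂) :+ a :* ((a :- con (+ 1)) :* X₃ :- b :* X₁)
            := a :* (b :* X₁ :+ (a :- con (+ 1)) :* X₃) :- b :* ((b :- con (+ 1)) :* X₂ :+ a :* X₁)) refl a b X₁ X₂ X₃ ⟩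
    a * (b * X₁ + (a - + 1) * X₃) - b * ((b - + 1) * X₂ + a * X₁)
      ≡⟨ cong₂ (λ u v → a * u - b * v) (Q-balance n (a - + 1) b) (Q-balance n a (b - + 1)) ⟩
    a * ((a - + 1 + b - + n) * Y₁) - b * ((a + (b - + 1) - + n) * Y₂)
      ≡⟨ solve 5 (λ a b Y₁ Y₂ N → a :* ((a :- con (+ 1) :+ b :- N) :* Y₁) :- b :* ((a :+ (b :- con (+ 1)) :- N) :* Y₂)
            := (a :+ b :- (con (+ 1) :+ N)) :* (a :* Y₁ :- b :* Y₂)) refl a b Y₁ Y₂ (+ n) ⟩
    (a + b - + suc n) * Q (suc n) a b ∎
    where X₁ = Q n (a - + 1) (b - + 1)
          X₂ = Q n a (b - + 1 - + 1)
          X₃ = Q n (a - + 1 - + 1) b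
          Y₁ = Q n (a - + 1) b
          Y₂ = Q n a (b - + 1)

  -- Raising the threshold α - β by one: if the weighted correlation of a nonempty I is given by F
  -- on the diagonal α + β = d, then one step up it is β F(α, β-1); at β = 0 the threshold exceeds m
  -- and the correlation vanishes by saturation.
  weighted-up : ∀ {m} (I : Subset m) d t (F : ℤ → ℤ → ℤ) → m ≡ suc d → ∣ I ∣ ≡ suc t →
    (∀ α β → α ℕ.+ β ≡ d → weighted I α β ≡ F (+ α) (+ β)) →
    ∀ α β → α ℕ.+ β ≡ suc d → + (α ! ℕ.* β !) * corr (+ α - + β + + 1) I ≡ + β * F (+ α) (+ β - + 1)
  weighted-up {m} I d t F refl ∣I∣≡1+t hyp α zero α+0≡m = begin
    + (α ! ℕ.* 1) * corr (+ α - + 0 + + 1) I  ≡⟨ cong (λ z → + (α ! ℕ.* 1) * corr z I) threshold ⟩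
    + (α ! ℕ.* 1) * corr (+ (m ℕ.+ suc 0)) I  ≡⟨ cong (+ (α ! ℕ.* 1) *_) (trans (corr-above I 0) (charSum-nonempty I t ∣I∣≡1+t)) ⟩
    + (α ! ℕ.* 1) * + 0                        ≡⟨ ℤP.*-zeroʳ (+ (α ! ℕ.* 1)) ⟩
    + 0 * F (+ α) (+ 0 - + 1)                  ∎
    where threshold : + α - + 0 + + 1 ≡ + (m ℕ.+ suc 0)
          threshold = trans (cong (_+ + 1) (ℤP.+-identityʳ (+ α)))
                            (trans (pos-suc α) (cong +_ (trans (cong suc (trans (sym (ℕP.+-identityʳ α)) α+0≡m)) (ℕP.+-comm 1 m))))
  weighted-up I d t F refl _ hyp α (suc b) α+1+b≡1+d = begin
    + (α ! ℕ.* suc b !) * corr (+ α - + suc b + + 1) I   ≡⟨ cong (λ z → + (α ! ℕ.* suc b !) * corr z I) (shift-up α b) ⟩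
    + (α ! ℕ.* suc b !) * corr (+ α - + b) I             ≡⟨ cong (λ z → + z * corr (+ α - + b) I) (x∙yz≈y∙xz (α !) (suc b) (b !)) ⟩
    + (suc b ℕ.* (α ! ℕ.* b !)) * corr (+ α - + b) I    ≡⟨ cong (_* corr (+ α - + b) I) (ℤP.pos-* (suc b) (α ! ℕ.* b !)) ⟩
    + suc b * + (α ! ℕ.* b !) * corr (+ α - + b) I      ≡⟨ ℤP.*-assoc (+ suc b) (+ (α ! ℕ.* b !)) _ ⟩
    + suc b * weighted I α b                             ≡⟨ cong (+ suc b *_) (hyp α b (ℕP.suc-injective (trans (sym (ℕP.+-suc α b)) α+1+b≡1+d))) ⟩
    + suc b * F (+ α) (+ b)                              ∎

  weighted-down : ∀ {m} (I : Subset m) d t (F : ℤ → ℤ → ℤ) → m ≡ suc d → ∣ I ∣ ≡ suc t →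
    (∀ α β → α ℕ.+ β ≡ d → weighted I α β ≡ F (+ α) (+ β)) →
    ∀ α β → α ℕ.+ β ≡ suc d → + (α ! ℕ.* β !) * corr (+ α - + β - + 1) I ≡ + α * F (+ α - + 1) (+ β)
  weighted-down {m} I d t F refl ∣I∣≡1+t hyp zero β refl = begin
    + (1 ℕ.* β !) * corr (+ 0 - + β - + 1) I     ≡⟨ cong (λ z → + (1 ℕ.* β !) * corr z I) threshold ⟩
    + (1 ℕ.* β !) * corr (-[1+ m ℕ.+ 0 ]) I      ≡⟨ cong (+ (1 ℕ.* β !) *_) (corr-below I 0) ⟩
    + (1 ℕ.* β !) * - (parity ∣ I ∣ * charSum I) ≡⟨ cong (λ z → + (1 ℕ.* β !) * - (parity ∣ I ∣ * z)) (charSum-nonempty I t ∣I∣≡1+t) ⟩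
    + (1 ℕ.* β !) * - (parity ∣ I ∣ * + 0)       ≡⟨ cong (λ z → + (1 ℕ.* β !) * - z) (ℤP.*-zeroʳ (parity ∣ I ∣)) ⟩
    + (1 ℕ.* β !) * + 0                           ≡⟨ ℤP.*-zeroʳ (+ (1 ℕ.* β !)) ⟩
    + 0 * F (+ 0 - + 1) (+ β)                     ∎
    where threshold : + 0 - + β - + 1 ≡ -[1+ β ℕ.+ 0 ]
          threshold = trans (solve 1 (λ B → con (+ 0) :- B :- con (+ 1) := :- (con (+ 1) :+ B)) refl (+ β))
                            (cong (λ z → - + suc z) (sym (ℕP.+-identityʳ β)))
  weighted-down I d t F refl _ hyp (suc a) β 1+a+β≡1+d = begin
    + (suc a ! ℕ.* β !) * corr (+ suc a - + β - + 1) I  ≡⟨ cong (λ z → + (suc a ! ℕ.* β !) * corr z I) (shift-down a β) ⟩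
    + (suc a ! ℕ.* β !) * corr (+ a - + β) I            ≡⟨ cong (_* corr (+ a - + β) I) (cong +_ (ℕP.*-assoc (suc a) (a !) (β !))) ⟩
    + (suc a ℕ.* (a ! ℕ.* β !)) * corr (+ a - + β) I    ≡⟨ cong (_* corr (+ a - + β) I) (ℤP.pos-* (suc a) (a ! ℕ.* β !)) ⟩
    + suc a * + (a ! ℕ.* β !) * corr (+ a - + β) I      ≡⟨ ℤP.*-assoc (+ suc a) (+ (a ! ℕ.* β !)) _ ⟩
    + suc a * weighted I a β                             ≡⟨ cong (+ suc a *_) (hyp a β (ℕP.suc-injective 1+a+β≡1+d)) ⟩
    + suc a * F (+ a) (+ β)                              ∎

  *-distribˡ-- : ∀ a x y → a * (x - y) ≡ a * x - a * y
  *-distribˡ-- = solve 3 (λ a x y → a :* (x :- y) := a :* x :- a :* y) refl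

  closedForm : ℕ → ℕ → ℤ → ℤ → ℤ
  closedForm n r a b = parity n * (+ 2 * (+ (r !) * Q n a b))

  -- Induction on I: a first coordinate inside I lowers |I| (the two threshold shifts reproduce the
  -- recursion of Q), one outside I lowers r (Q-balance recombines the two shifts).
  weighted-formula : ∀ {m} (I : Subset m) n r → ∣ I ∣ ≡ suc n → m ≡ suc (n ℕ.+ r) →
    ∀ α β → α ℕ.+ β ≡ n ℕ.+ r → weighted I α β ≡ closedForm n r (+ α) (+ β)
  weighted-formula (inside ∷ I) zero r ∣I∣≡1 m≡1+r α β α+β≡r = begin
    weighted (inside ∷ I) α β ≡⟨ weighted-singleton I α β (ℕP.suc-injective ∣I∣≡1) (trans (ℕP.suc-injective m≡1+r) (sym α+β≡r)) ⟩
    + 2 * + ((α ℕ.+ β) !)      ≡⟨ cong (λ z → + 2 * + (z !)) α+β≡r ⟩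
    + 2 * + (r !)              ≡⟨ solve 1 (λ F → con (+ 2) :* F := con (+ 1) :* (con (+ 2) :* (F :* con (+ 1)))) refl (+ (r !)) ⟩
    closedForm 0 r (+ α) (+ β) ∎
  weighted-formula (inside ∷ I) (suc n) r ∣I∣≡2+n m≡2+n+r α β α+β≡1+n+r = begin
    + F * corr (+ α - + β) (inside ∷ I)                          ≡⟨ cong (+ F *_) (corr-inside (+ α - + β) I) ⟩
    + F * (corr (+ α - + β + + 1) I - corr (+ α - + β - + 1) I)  ≡⟨ *-distribˡ-- (+ F) _ _ ⟩
    + F * corr (+ α - + β + + 1) I - + F * corr (+ α - + β - + 1) I
      ≡⟨ cong₂ _-_ (weighted-up I (n ℕ.+ r) n G m′ ∣I∣≡1+n hyp α β α+β≡1+n+r)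
                   (weighted-down I (n ℕ.+ r) n G m′ ∣I∣≡1+n hyp α β α+β≡1+n+r) ⟩
    + β * G (+ α) (+ β - + 1) - + α * G (+ α - + 1) (+ β)
      ≡⟨ solve 6 (λ S R A B Q₁ Q₂ → B :* (S :* (con (+ 2) :* (R :* Q₂))) :- A :* (S :* (con (+ 2) :* (R :* Q₁)))
            := (:- S) :* (con (+ 2) :* (R :* (A :* Q₁ :- B :* Q₂)))) refl
            (parity n) (+ (r !)) (+ α) (+ β) (Q n (+ α - + 1) (+ β)) (Q n (+ α) (+ β - + 1)) ⟩
    closedForm (suc n) r (+ α) (+ β)                             ∎
    where F = α ! ℕ.* β !
          G = closedForm n r
          ∣I∣≡1+n = ℕP.suc-injective ∣I∣≡2+n
          m′ = ℕP.suc-injective m≡2+n+r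
          hyp = weighted-formula I n r ∣I∣≡1+n m′
  weighted-formula {suc m} (outside ∷ I) n zero ∣I∣≡1+n m≡1+n+0 α β _ =
    ⊥-elim (ℕP.<-irrefl refl (subst (suc n ℕ.≤_) (trans (ℕP.suc-injective m≡1+n+0) (ℕP.+-identityʳ n))
      (subst (ℕ._≤ m) ∣I∣≡1+n (∣p∣≤n I))))
  weighted-formula (outside ∷ I) n (suc r) ∣I∣≡1+n m≡2+n+r α β α+β≡n+1+r = begin
    + F * corr (+ α - + β) (outside ∷ I)                         ≡⟨ cong (+ F *_) (corr-outside (+ α - + β) I) ⟩
    + F * (corr (+ α - + β + + 1) I + corr (+ α - + β - + 1) I)  ≡⟨ ℤP.*-distribˡ-+ (+ F) _ _ ⟩
    + F * corr (+ α - + β + + 1) I + + F * corr (+ α - + β - + 1) I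
      ≡⟨ cong₂ _+_ (weighted-up I (n ℕ.+ r) n G m′ ∣I∣≡1+n hyp α β α+β≡1+n+r)
                   (weighted-down I (n ℕ.+ r) n G m′ ∣I∣≡1+n hyp α β α+β≡1+n+r) ⟩
    + β * G (+ α) (+ β - + 1) + + α * G (+ α - + 1) (+ β)
      ≡⟨ solve 6 (λ S R A B Q₁ Q₂ → B :* (S :* (con (+ 2) :* (R :* Q₂))) :+ A :* (S :* (con (+ 2) :* (R :* Q₁)))
            := S :* (con (+ 2) :* (R :* (B :* Q₂ :+ A :* Q₁)))) refl
            (parity n) (+ (r !)) (+ α) (+ β) (Q n (+ α - + 1) (+ β)) (Q n (+ α) (+ β - + 1)) ⟩
    parity n * (+ 2 * (+ (r !) * (+ β * Q n (+ α) (+ β - + 1) + + α * Q n (+ α - + 1) (+ β))))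
      ≡⟨ cong (λ z → parity n * (+ 2 * (+ (r !) * z))) (trans (Q-balance n (+ α) (+ β)) (cong (_* Q n (+ α) (+ β)) α+β-n≡1+r)) ⟩
    parity n * (+ 2 * (+ (r !) * (+ suc r * Q n (+ α) (+ β))))
      ≡⟨ cong (λ z → parity n * (+ 2 * z)) (trans (sym (ℤP.*-assoc (+ (r !)) (+ suc r) _))
           (cong (_* Q n (+ α) (+ β)) (trans (ℤP.*-comm (+ (r !)) (+ suc r)) (sym (ℤP.pos-* (suc r) (r !)))))) ⟩
    closedForm n (suc r) (+ α) (+ β)                             ∎
    where F = α ! ℕ.* β !
          G = closedForm n r
          m′ = trans (ℕP.suc-injective m≡2+n+r) (ℕP.+-suc n r)
          α+β≡1+n+r = trans α+β≡n+1+r (ℕP.+-suc n r)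
          hyp = weighted-formula I n r ∣I∣≡1+n m′
          α+β-n≡1+r : + α + + β - + n ≡ + suc r
          α+β-n≡1+r = trans (cong (_- + n) (trans (sym (ℤP.pos-+ α β)) (trans (cong +_ α+β≡n+1+r) (ℤP.pos-+ n (suc r)))))
                            (solve 2 (λ N R → N :+ R :- N := R) refl (+ n) (+ suc r))

  -- Since χ_{s ∷ J}(x₁, y) is x₁ χ_J(y) for s = inside and χ_J(y) otherwise, the president's two values
  -- contribute corr(c, J) - sideSign(s) · corr(-c, J).
  sideSign : Side → ℤ
  sideSign inside = + 1
  sideSign outside = -[1+ 0 ]

  times-minus-one : ∀ c → c * -[1+ 0 ] ≡ - c
  times-minus-one c = trans (ℤP.*-comm c -[1+ 0 ]) (ℤP.-1*i≡-i c)

  president-split : ∀ {m} c s (J : Subset m) →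
    sumOver (λ x → signum (linearForm c x) * character (s ∷ J) x) (allPoints (suc m)) ≡ corr c J - sideSign s * corr (- c) J
  president-split {m} c inside J = begin
    _ ≡⟨ cube-split (λ x → signum (linearForm c x) * character (inside ∷ J) x) ⟩
    _ ≡⟨ cong₂ _+_ (sumOver-cong (λ y → cong₂ (λ z w → signum (z + spinSum y) * w) (ℤP.*-identityʳ c) (ℤP.*-identityˡ (character J y))) (allPoints m))
                   (sumOver-cong (λ y → trans (cong₂ (λ z w → signum (z + spinSum y) * w) (times-minus-one c) (ℤP.-1*i≡-i (character J y)))
                                              (sym (ℤP.neg-distribʳ-* (signum (- c + spinSum y)) (character J y)))) (allPoints m)) ⟩
    corr c J + sumOver (λ y → - (signum (- c + spinSum y) * character J y)) (allPoints m)
      ≡⟨ cong (λ z → corr c J + z) (sumOver-neg (λ y → signum (- c + spinSum y) * character J y) (allPoints m)) ⟩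
    corr c J - corr (- c) J          ≡⟨ cong (λ z → corr c J - z) (sym (ℤP.*-identityˡ (corr (- c) J))) ⟩
    corr c J - + 1 * corr (- c) J    ∎
  president-split {m} c outside J = begin
    _ ≡⟨ cube-split (λ x → signum (linearForm c x) * character (outside ∷ J) x) ⟩
    _ ≡⟨ cong₂ _+_ (sumOver-cong (λ y → cong (λ z → signum (z + spinSum y) * character J y) (ℤP.*-identityʳ c)) (allPoints m))
                   (sumOver-cong (λ y → cong (λ z → signum (z + spinSum y) * character J y) (times-minus-one c)) (allPoints m)) ⟩
    corr c J + corr (- c) J                     ≡⟨ solve 2 (λ x y → x :+ y := x :- con -[1+ 0 ] :* y) refl (corr c J) (corr (- c) J) ⟩
    corr c J - -[1+ 0 ] * corr (- c) J          ∎

  -- When (-1)^|J| equals the president's sideSign, both halves contribute corr(c, J) by symmetry.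
  president-double : ∀ {m} c s (J : Subset m) → parity ∣ J ∣ ≡ sideSign s →
    sumOver (λ x → signum (linearForm c x) * character (s ∷ J) x) (allPoints (suc m)) ≡ + 2 * corr c J
  president-double c s J parity≡side = begin
    _                                                    ≡⟨ president-split c s J ⟩
    corr c J - sideSign s * corr (- c) J                 ≡⟨ cong (λ z → corr c J - sideSign s * z) (corr-neg J c) ⟩
    corr c J - sideSign s * - (parity ∣ J ∣ * corr c J)  ≡⟨ cong (λ p → corr c J - sideSign s * - (p * corr c J)) parity≡side ⟩
    corr c J - sideSign s * - (sideSign s * corr c J)    ≡⟨ doubling s (corr c J) ⟩
    + 2 * corr c J                                       ∎
    where doubling : ∀ s x → x - sideSign s * - (sideSign s * x) ≡ + 2 * x
          doubling inside = solve 1 (λ x → x :- con (+ 1) :* :- (con (+ 1) :* x) := con (+ 2) :* x) refl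
          doubling outside = solve 1 (λ x → x :- con -[1+ 0 ] :* :- (con -[1+ 0 ] :* x) := con (+ 2) :* x) refl

module ErrorBound where

  open import Data.Nat as ℕ using (ℕ; zero; suc; _≤_; _^_)
  open import Data.Integer as ℤ using (ℤ; +_; -[1+_]; _+_; _*_; -_; _-_; ∣_∣)
  import Data.Integer.Properties as ℤP
  import Data.Nat.Properties as ℕP
  open import Relation.Binary.PropositionalEquality
  open import Data.Integer.Solver using (module +-*-Solver)
  import Data.Nat.Solver as ℕSolver
  open SignSums using (Q)

  open +-*-Solver using (solve; _:+_; _:*_; _:-_; :-_; con; _:=_)
  module ℕS = ℕSolver.+-*-Solver

  abs-^ : ∀ i n → ∣ i ℤ.^ n ∣ ≡ ∣ i ∣ ^ n
  abs-^ i zero = refl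
  abs-^ i (suc n) = trans (ℤP.abs-* i (i ℤ.^ n)) (cong (∣ i ∣ ℕ.*_) (abs-^ i n))

  ∣e∣≡1⇒∣ex∣≡∣x∣ : ∀ e x → ∣ e ∣ ≡ 1 → ∣ e * x ∣ ≡ ∣ x ∣
  ∣e∣≡1⇒∣ex∣≡∣x∣ e x ∣e∣≡1 = trans (ℤP.abs-* e x) (trans (cong (ℕ._* ∣ x ∣) ∣e∣≡1) (ℕP.*-identityˡ ∣ x ∣))

  firstOrderConst : ℕ → ℕ
  firstOrderConst zero = 1
  firstOrderConst (suc q) = 2 ℕ.* firstOrderConst q ℕ.+ 1

  secondOrderConst : ℕ → ℕ
  secondOrderConst zero = 1
  secondOrderConst (suc q) = 2 ℕ.* secondOrderConst q ℕ.+ suc (suc q)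

  scaledFirstOrderConst : ℕ → ℕ
  scaledFirstOrderConst zero = 0
  scaledFirstOrderConst (suc q) = firstOrderConst q

  module Taylor (c : ℤ) (k : ℕ) (∣c∣≤k : ∣ c ∣ ≤ k) (e : ℤ) (∣e∣≡1 : ∣ e ∣ ≡ 1) (1≤k : 1 ≤ k) where

    pow-bound : ∀ n → ∣ c ℤ.^ n ∣ ≤ k ^ n
    pow-bound n = ℕP.≤-trans (ℕP.≤-reflexive (abs-^ c n)) (ℕP.^-monoˡ-≤ n ∣c∣≤k)

    step-bound : ∣ c + e ∣ ≤ 2 ℕ.* k
    step-bound = ℕP.≤-trans (ℤP.∣i+j∣≤∣i∣+∣j∣ c e) (ℕP.≤-trans (ℕP.+-mono-≤ ∣c∣≤k (ℕP.≤-trans (ℕP.≤-reflexive ∣e∣≡1) 1≤k))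
                   (ℕP.≤-reflexive (cong (k ℕ.+_) (sym (ℕP.+-identityʳ k)))))

    first-order : ∀ q → ∣ (c + e) ℤ.^ suc q - c ℤ.^ suc q ∣ ≤ firstOrderConst q ℕ.* k ^ q
    first-order zero = ℕP.≤-reflexive (trans (cong ∣_∣ (solve 2 (λ c e → (c :+ e) :* con (+ 1) :- c :* con (+ 1) := e) refl c e)) ∣e∣≡1)
    first-order (suc q) = begin
      ∣ (c + e) ℤ.^ suc (suc q) - c ℤ.^ suc (suc q) ∣  ≡⟨ cong ∣_∣ regroup ⟩
      ∣ (c + e) * D + e * c ℤ.^ suc q ∣               ≤⟨ ℤP.∣i+j∣≤∣i∣+∣j∣ ((c + e) * D) (e * c ℤ.^ suc q) ⟩
      ∣ (c + e) * D ∣ ℕ.+ ∣ e * c ℤ.^ suc q ∣          ≡⟨ cong₂ ℕ._+_ (ℤP.abs-* (c + e) D) (∣e∣≡1⇒∣ex∣≡∣x∣ e (c ℤ.^ suc q) ∣e∣≡1) ⟩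
      ∣ c + e ∣ ℕ.* ∣ D ∣ ℕ.+ ∣ c ℤ.^ suc q ∣           ≤⟨ ℕP.+-mono-≤ (ℕP.*-mono-≤ step-bound (first-order q)) (pow-bound (suc q)) ⟩
      2 ℕ.* k ℕ.* (firstOrderConst q ℕ.* k ^ q) ℕ.+ k ^ suc q
        ≡⟨ ℕS.solve 3 (λ K A X → ℕS.con 2 ℕS.:* K ℕS.:* (A ℕS.:* X) ℕS.:+ K ℕS.:* X ℕS.:= (ℕS.con 2 ℕS.:* A ℕS.:+ ℕS.con 1) ℕS.:* (K ℕS.:* X))
             refl k (firstOrderConst q) (k ^ q) ⟩
      firstOrderConst (suc q) ℕ.* k ^ suc q          ∎
      where
      open ℕP.≤-Reasoning
      D = (c + e) ℤ.^ suc q - c ℤ.^ suc q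
      regroup : (c + e) ℤ.^ suc (suc q) - c ℤ.^ suc (suc q) ≡ (c + e) * D + e * c ℤ.^ suc q
      regroup = solve 4 (λ c e Y Z → (c :+ e) :* Y :- c :* Z := (c :+ e) :* (Y :- Z) :+ e :* Z) refl c e ((c + e) ℤ.^ suc q) (c ℤ.^ suc q)

    second-order : ∀ q → ∣ (c + e) ℤ.^ suc (suc q) - c ℤ.^ suc (suc q) - + suc (suc q) * e * c ℤ.^ suc q ∣ ≤ secondOrderConst q ℕ.* k ^ q
    second-order zero = ℕP.≤-reflexive (trans (cong ∣_∣ (solve 2 (λ c e → (c :+ e) :* ((c :+ e) :* con (+ 1)) :- c :* (c :* con (+ 1)) :- con (+ 2) :* e :* (c :* con (+ 1)) := e :* e) refl c e))
      (trans (ℤP.abs-* e e) (cong₂ ℕ._*_ ∣e∣≡1 ∣e∣≡1)))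
    second-order (suc q) = begin
      ∣ (c + e) * Y - c * (c * Z) - + suc (suc (suc q)) * e * (c * Z) ∣  ≡⟨ cong ∣_∣ regroup ⟩
      ∣ (c + e) * D + + suc (suc q) * (e * e) * Z ∣
        ≤⟨ ℤP.∣i+j∣≤∣i∣+∣j∣ ((c + e) * D) (+ suc (suc q) * (e * e) * Z) ⟩
      ∣ (c + e) * D ∣ ℕ.+ ∣ + suc (suc q) * (e * e) * Z ∣
        ≡⟨ cong₂ ℕ._+_ (ℤP.abs-* (c + e) D) ∣qeeZ∣ ⟩
      ∣ c + e ∣ ℕ.* ∣ D ∣ ℕ.+ suc (suc q) ℕ.* ∣ Z ∣
        ≤⟨ ℕP.+-mono-≤ (ℕP.*-mono-≤ step-bound (second-order q)) (ℕP.*-monoʳ-≤ (suc (suc q)) (pow-bound (suc q))) ⟩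
      2 ℕ.* k ℕ.* (secondOrderConst q ℕ.* k ^ q) ℕ.+ suc (suc q) ℕ.* k ^ suc q
        ≡⟨ ℕS.solve 4 (λ K B X Q → ℕS.con 2 ℕS.:* K ℕS.:* (B ℕS.:* X) ℕS.:+ (ℕS.con 2 ℕS.:+ Q) ℕS.:* (K ℕS.:* X)
              ℕS.:= (ℕS.con 2 ℕS.:* B ℕS.:+ (ℕS.con 2 ℕS.:+ Q)) ℕS.:* (K ℕS.:* X)) refl k (secondOrderConst q) (k ^ q) q ⟩
      secondOrderConst (suc q) ℕ.* k ^ suc q ∎
      where
      open ℕP.≤-Reasoning
      Y = (c + e) ℤ.^ suc (suc q)
      Z = c ℤ.^ suc q
      D = Y - c * Z - + suc (suc q) * e * Z
      regroup : (c + e) * Y - c * (c * Z) - + suc (suc (suc q)) * e * (c * Z) ≡ (c + e) * D + + suc (suc q) * (e * e) * Z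
      regroup = solve 5 (λ c e Y Z P → (c :+ e) :* Y :- c :* (c :* Z) :- (con (+ 3) :+ P) :* e :* (c :* Z)
                  := (c :+ e) :* (Y :- c :* Z :- (con (+ 2) :+ P) :* e :* Z) :+ (con (+ 2) :+ P) :* (e :* e) :* Z) refl c e Y Z (+ q)
      ∣qeeZ∣ : ∣ + suc (suc q) * (e * e) * Z ∣ ≡ suc (suc q) ℕ.* ∣ Z ∣
      ∣qeeZ∣ = trans (ℤP.abs-* (+ suc (suc q) * (e * e)) Z) (cong (ℕ._* ∣ Z ∣)
                 (trans (ℤP.abs-* (+ suc (suc q)) (e * e)) (trans (cong (suc (suc q) ℕ.*_) (∣e∣≡1⇒∣ex∣≡∣x∣ e e ∣e∣≡1)) (trans (cong (suc (suc q) ℕ.*_) ∣e∣≡1) (ℕP.*-identityʳ (suc (suc q)))))))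

    first-order-scaled : ∀ p → k ℕ.* ∣ (c + e) ℤ.^ p - c ℤ.^ p ∣ ≤ scaledFirstOrderConst p ℕ.* k ^ p
    first-order-scaled zero = ℕP.≤-reflexive (ℕP.*-zeroʳ k)
    first-order-scaled (suc q) = ℕP.≤-trans (ℕP.*-monoʳ-≤ k (first-order q))
      (ℕP.≤-reflexive (ℕS.solve 3 (λ K A X → K ℕS.:* (A ℕS.:* X) ℕS.:= A ℕS.:* (K ℕS.:* X)) refl k (firstOrderConst q) (k ^ q)))

  -- triangular p = C(p+2, 2).
  triangular : ℕ → ℕ
  triangular zero = 1
  triangular (suc p) = triangular p ℕ.+ suc (suc p)

  approx′ : ℕ → ℤ → ℤ → ℤ
  approx′ p c s = c ℤ.^ suc (suc p) - + triangular p * c ℤ.^ p * s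

  approx : ℕ → ℤ → ℤ → ℤ
  approx p a b = approx′ p (a - b) (a + b + + 2)

  defect : ℕ → ℤ → ℤ → ℤ
  defect p a b = a * approx p (a - + 1) b - b * approx p a (b - + 1) - approx (suc p) a b

  -- Since Q obeys its recursion exactly, the error Q - approx obeys it up to the defect.
  error-step : ∀ p a b → Q (suc (suc (suc p))) a b - approx (suc p) a b
    ≡ a * (Q (suc (suc p)) (a - + 1) b - approx p (a - + 1) b) - b * (Q (suc (suc p)) a (b - + 1) - approx p a (b - + 1)) + defect p a b
  error-step p a b = solve 7 (λ a b Q₁ Q₂ M₁ M₂ M → a :* Q₁ :- b :* Q₂ :- M := a :* (Q₁ :- M₁) :- b :* (Q₂ :- M₂) :+ (a :* M₁ :- b :* M₂ :- M)) refl
    a b (Q (suc (suc p)) (a - + 1) b) (Q (suc (suc p)) a (b - + 1)) (approx p (a - + 1) b) (approx p a (b - + 1)) (approx (suc p) a b)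

  defectConst : ℕ → ℕ
  defectConst p = (2 ℕ.* suc (suc p) ℕ.+ triangular p) ℕ.+ secondOrderConst p ℕ.+ secondOrderConst p ℕ.+ 2 ℕ.* (triangular p ℕ.* scaledFirstOrderConst p)

  triangle3 : ∀ x y z → ∣ x - y + z ∣ ≤ ∣ x ∣ ℕ.+ ∣ y ∣ ℕ.+ ∣ z ∣
  triangle3 x y z = ℕP.≤-trans (ℤP.∣i+j∣≤∣i∣+∣j∣ (x - y) z) (ℕP.+-monoˡ-≤ ∣ z ∣ (ℤP.∣i-j∣≤∣i∣+∣j∣ x y))

  triangle4 : ∀ x₁ x₂ x₃ x₄ → ∣ x₁ + x₂ - x₃ - x₄ ∣ ≤ ∣ x₁ ∣ ℕ.+ ∣ x₂ ∣ ℕ.+ ∣ x₃ ∣ ℕ.+ ∣ x₄ ∣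
  triangle4 x₁ x₂ x₃ x₄ =
    ℕP.≤-trans (ℤP.∣i-j∣≤∣i∣+∣j∣ (x₁ + x₂ - x₃) x₄) (ℕP.+-monoˡ-≤ ∣ x₄ ∣
    (ℕP.≤-trans (ℤP.∣i-j∣≤∣i∣+∣j∣ (x₁ + x₂) x₃) (ℕP.+-monoˡ-≤ ∣ x₃ ∣ (ℤP.∣i+j∣≤∣i∣+∣j∣ x₁ x₂))))

  -- The defect is of order k^{p+1}, k = a + b + 2: it regroups into a term (const)·c·cᵖ and
  -- Taylor remainders of (c ∓ 1)^{p+2} and (c ∓ 1)^p around c = a - b.
  defect-bound : ∀ p α β → ∣ defect p (+ α) (+ β) ∣ ≤ defectConst p ℕ.* (α ℕ.+ β ℕ.+ 2) ^ suc p
  defect-bound p α β = begin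
    ∣ defect p a b ∣                                  ≡⟨ cong ∣_∣ regroup ⟩
    ∣ T₁ + T₂ - T₃ - T₄ ∣                             ≤⟨ triangle4 T₁ T₂ T₃ T₄ ⟩
    ∣ T₁ ∣ ℕ.+ ∣ T₂ ∣ ℕ.+ ∣ T₃ ∣ ℕ.+ ∣ T₄ ∣
      ≤⟨ ℕP.+-mono-≤ (ℕP.+-mono-≤ (ℕP.+-mono-≤ bound₁ bound₂) bound₃) bound₄ ⟩
    c₁ ℕ.* (k ℕ.* k ^ p) ℕ.+ k ℕ.* (B ℕ.* k ^ p) ℕ.+ k ℕ.* (B ℕ.* k ^ p) ℕ.+ triangular p ℕ.* k ℕ.* (G ℕ.* k ^ p ℕ.+ G ℕ.* k ^ p)
      ≡⟨ ℕS.solve 6 (λ K X C B G Tr → C ℕS.:* (K ℕS.:* X) ℕS.:+ K ℕS.:* (B ℕS.:* X) ℕS.:+ K ℕS.:* (B ℕS.:* X) ℕS.:+ Tr ℕS.:* K ℕS.:* (G ℕS.:* X ℕS.:+ G ℕS.:* X)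
            ℕS.:= (C ℕS.:+ B ℕS.:+ B ℕS.:+ ℕS.con 2 ℕS.:* (Tr ℕS.:* G)) ℕS.:* (K ℕS.:* X)) refl k (k ^ p) c₁ B G (triangular p) ⟩
    defectConst p ℕ.* k ^ suc p                       ∎
    where
    open ℕP.≤-Reasoning
    a = + α
    b = + β
    c = a - b
    k = α ℕ.+ β ℕ.+ 2
    B = secondOrderConst p
    G = scaledFirstOrderConst p
    c₁ = 2 ℕ.* suc (suc p) ℕ.+ triangular p
    X = c ℤ.^ p
    Y₋ = (c - + 1) ℤ.^ suc (suc p)
    Y₊ = (c + + 1) ℤ.^ suc (suc p)
    Z₋ = (c - + 1) ℤ.^ p
    Z₊ = (c + + 1) ℤ.^ p
    t = + triangular p
    P = + p
    T₁ = (+ 2 * (+ 2 + P) + t) * (c * X)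
    T₂ = a * (Y₋ - c * (c * X) - (+ 2 + P) * -[1+ 0 ] * (c * X))
    T₃ = b * (Y₊ - c * (c * X) - (+ 2 + P) * + 1 * (c * X))
    T₄ = t * (a + b + + 1) * (a * (Z₋ - X) - b * (Z₊ - X))
    shifted-args : a * approx p (a - + 1) b - b * approx p a (b - + 1) - approx (suc p) a b
      ≡ a * approx′ p (c - + 1) (a + b + + 1) - b * approx′ p (c + + 1) (a + b + + 1) - approx′ (suc p) c (a + b + + 2)
    shifted-args = cong₂ (λ x y → a * x - b * y - approx (suc p) a b)
      (cong₂ (approx′ p) (solve 2 (λ a b → a :- con (+ 1) :- b := (a :- b) :- con (+ 1)) refl a b)
                         (solve 2 (λ a b → a :- con (+ 1) :+ b :+ con (+ 2) := a :+ b :+ con (+ 1)) refl a b))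
      (cong₂ (approx′ p) (solve 2 (λ a b → a :- (b :- con (+ 1)) := (a :- b) :+ con (+ 1)) refl a b)
                         (solve 2 (λ a b → a :+ (b :- con (+ 1)) :+ con (+ 2) := a :+ b :+ con (+ 1)) refl a b))
    regroup : defect p a b ≡ T₁ + T₂ - T₃ - T₄
    regroup = trans shifted-args (trans
      (cong (λ z → a * approx′ p (c - + 1) (a + b + + 1) - b * approx′ p (c + + 1) (a + b + + 1) - (c ℤ.^ suc (suc (suc p)) - z * c ℤ.^ suc p * (a + b + + 2)))
            (ℤP.pos-+ (triangular p) (suc (suc p))))
      (solve 9 (λ a b t P X Y₋ Y₊ Z₋ Z₊ →
             a :* (Y₋ :- t :* Z₋ :* (a :+ b :+ con (+ 1))) :- b :* (Y₊ :- t :* Z₊ :* (a :+ b :+ con (+ 1)))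
               :- ((a :- b) :* ((a :- b) :* ((a :- b) :* X)) :- (t :+ (con (+ 2) :+ P)) :* ((a :- b) :* X) :* (a :+ b :+ con (+ 2)))
             := (con (+ 2) :* (con (+ 2) :+ P) :+ t) :* ((a :- b) :* X)
               :+ a :* (Y₋ :- (a :- b) :* ((a :- b) :* X) :- (con (+ 2) :+ P) :* con -[1+ 0 ] :* ((a :- b) :* X))
               :- b :* (Y₊ :- (a :- b) :* ((a :- b) :* X) :- (con (+ 2) :+ P) :* con (+ 1) :* ((a :- b) :* X))
               :- t :* (a :+ b :+ con (+ 1)) :* (a :* (Z₋ :- X) :- b :* (Z₊ :- X))) refl a b t P X Y₋ Y₊ Z₋ Z₊))
    α≤k : α ≤ k
    α≤k = ℕP.≤-trans (ℕP.m≤m+n α β) (ℕP.m≤m+n (α ℕ.+ β) 2)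
    β≤k : β ≤ k
    β≤k = ℕP.≤-trans (ℕP.m≤n+m β α) (ℕP.m≤m+n (α ℕ.+ β) 2)
    ∣c∣≤k : ∣ c ∣ ≤ k
    ∣c∣≤k = ℕP.≤-trans (ℤP.∣i-j∣≤∣i∣+∣j∣ a b) (ℕP.m≤m+n (α ℕ.+ β) 2)
    1≤k : 1 ≤ k
    1≤k = ℕP.≤-trans (ℕ.s≤s ℕ.z≤n) (ℕP.m≤n+m 2 (α ℕ.+ β))
    module Down = Taylor c k ∣c∣≤k -[1+ 0 ] refl 1≤k
    module Up = Taylor c k ∣c∣≤k (+ 1) refl 1≤k
    bound₁ : ∣ T₁ ∣ ≤ c₁ ℕ.* (k ℕ.* k ^ p)
    bound₁ = ℕP.≤-trans (ℕP.≤-reflexive (trans (ℤP.abs-* (+ 2 * (+ 2 + P) + t) (c * X))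
               (cong₂ ℕ._*_ (cong ∣_∣ (trans (cong (_+ t) (sym (ℤP.pos-* 2 (suc (suc p))))) (sym (ℤP.pos-+ (2 ℕ.* suc (suc p)) (triangular p)))))
                            (ℤP.abs-* c X))))
             (ℕP.*-monoʳ-≤ c₁ (ℕP.*-mono-≤ ∣c∣≤k (Down.pow-bound p)))
    bound₂ : ∣ T₂ ∣ ≤ k ℕ.* (B ℕ.* k ^ p)
    bound₂ = ℕP.≤-trans (ℕP.≤-reflexive (ℤP.abs-* a _)) (ℕP.*-mono-≤ α≤k (Down.second-order p))
    bound₃ : ∣ T₃ ∣ ≤ k ℕ.* (B ℕ.* k ^ p)
    bound₃ = ℕP.≤-trans (ℕP.≤-reflexive (ℤP.abs-* b _)) (ℕP.*-mono-≤ β≤k (Up.second-order p))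
    ∣a+b+1∣≤k : ∣ a + b + + 1 ∣ ≤ k
    ∣a+b+1∣≤k = ℕP.≤-trans (ℕP.≤-reflexive (cong ∣_∣ (trans (cong (_+ + 1) (sym (ℤP.pos-+ α β))) (sym (ℤP.pos-+ (α ℕ.+ β) 1)))))
                  (ℕP.+-monoʳ-≤ (α ℕ.+ β) (ℕ.s≤s ℕ.z≤n))
    bound₄ : ∣ T₄ ∣ ≤ triangular p ℕ.* k ℕ.* (G ℕ.* k ^ p ℕ.+ G ℕ.* k ^ p)
    bound₄ = ℕP.≤-trans (ℕP.≤-reflexive (trans (ℤP.abs-* (t * (a + b + + 1)) _) (cong (ℕ._* ∣ a * (Z₋ - X) - b * (Z₊ - X) ∣) (ℤP.abs-* t (a + b + + 1)))))
      (ℕP.*-mono-≤ (ℕP.*-monoʳ-≤ (triangular p) ∣a+b+1∣≤k) (ℕP.≤-trans (ℤP.∣i-j∣≤∣i∣+∣j∣ (a * (Z₋ - X)) (b * (Z₊ - X))) (ℕP.+-mono-≤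
        (ℕP.≤-trans (ℕP.≤-reflexive (ℤP.abs-* a (Z₋ - X))) (ℕP.≤-trans (ℕP.*-monoˡ-≤ ∣ Z₋ - X ∣ α≤k) (Down.first-order-scaled p)))
        (ℕP.≤-trans (ℕP.≤-reflexive (ℤP.abs-* b (Z₊ - X))) (ℕP.≤-trans (ℕP.*-monoˡ-≤ ∣ Z₊ - X ∣ β≤k) (Up.first-order-scaled p))))))

  -- The error constant K_p: K₀ = 2 since Q₂ - approx₀ = 2 exactly, and K_{p+1} = D_p + 2 K_p.
  errorConst : ℕ → ℕ
  errorConst zero = 2
  errorConst (suc p) = defectConst p ℕ.+ errorConst p ℕ.+ errorConst p

  -- Two-term asymptotics of Q: |Q_{p+2}(α,β) - approx_p(α,β)| ≤ K_p (α+β+2)^p, by induction on p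
  -- through error-step; the neighbouring errors enter with the factors α, β ≤ α+β+2.
  error-bound : ∀ p α β → ∣ Q (suc (suc p)) (+ α) (+ β) - approx p (+ α) (+ β) ∣ ≤ errorConst p ℕ.* (α ℕ.+ β ℕ.+ 2) ^ p

  -- The neighbouring errors, weighted by α and β (the weight vanishes where the neighbour leaves ℕ).
  weighted-error-left : ∀ p α β →
    ∣ + α * (Q (suc (suc p)) (+ α - + 1) (+ β) - approx p (+ α - + 1) (+ β)) ∣ ≤ (α ℕ.+ β ℕ.+ 2) ℕ.* (errorConst p ℕ.* (α ℕ.+ β ℕ.+ 2) ^ p)
  weighted-error-right : ∀ p α β →
    ∣ + β * (Q (suc (suc p)) (+ α) (+ β - + 1) - approx p (+ α) (+ β - + 1)) ∣ ≤ (α ℕ.+ β ℕ.+ 2) ℕ.* (errorConst p ℕ.* (α ℕ.+ β ℕ.+ 2) ^ p)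

  error-bound zero α β = ℕP.≤-reflexive (cong ∣_∣ (solve 2 (λ a b →
    a :* ((a :- con (+ 1)) :* con (+ 1) :- b :* con (+ 1)) :- b :* (a :* con (+ 1) :- (b :- con (+ 1)) :* con (+ 1))
    :- ((a :- b) :* ((a :- b) :* con (+ 1)) :- con (+ 1) :* con (+ 1) :* (a :+ b :+ con (+ 2))) := con (+ 2)) refl (+ α) (+ β)))
  error-bound (suc p) α β = begin
    ∣ Q (suc (suc (suc p))) a b - approx (suc p) a b ∣        ≡⟨ cong ∣_∣ (error-step p a b) ⟩
    ∣ a * E₋ - b * E₊ + defect p a b ∣                        ≤⟨ triangle3 (a * E₋) (b * E₊) (defect p a b) ⟩
    ∣ a * E₋ ∣ ℕ.+ ∣ b * E₊ ∣ ℕ.+ ∣ defect p a b ∣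
      ≤⟨ ℕP.+-mono-≤ (ℕP.+-mono-≤ (weighted-error-left p α β) (weighted-error-right p α β)) (defect-bound p α β) ⟩
    k ℕ.* (K ℕ.* k ^ p) ℕ.+ k ℕ.* (K ℕ.* k ^ p) ℕ.+ defectConst p ℕ.* (k ℕ.* k ^ p)
      ≡⟨ ℕS.solve 4 (λ k X K D → k ℕS.:* (K ℕS.:* X) ℕS.:+ k ℕS.:* (K ℕS.:* X) ℕS.:+ D ℕS.:* (k ℕS.:* X) ℕS.:= (D ℕS.:+ K ℕS.:+ K) ℕS.:* (k ℕS.:* X))
           refl k (k ^ p) K (defectConst p) ⟩
    errorConst (suc p) ℕ.* k ^ suc p                          ∎
    where
    open ℕP.≤-Reasoning
    a = + α
    b = + β
    k = α ℕ.+ β ℕ.+ 2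
    K = errorConst p
    E₋ = Q (suc (suc p)) (a - + 1) b - approx p (a - + 1) b
    E₊ = Q (suc (suc p)) a (b - + 1) - approx p a (b - + 1)

  weighted-error-left p zero β = ℕ.z≤n
  weighted-error-left p (suc α) β = ℕP.≤-trans (ℕP.≤-reflexive (ℤP.abs-* (+ suc α) (Q (suc (suc p)) (+ α) (+ β) - approx p (+ α) (+ β))))
    (ℕP.*-mono-≤ (ℕP.≤-trans (ℕP.m≤m+n (suc α) β) (ℕP.m≤m+n (suc α ℕ.+ β) 2))
                 (ℕP.≤-trans (error-bound p α β) (ℕP.*-monoʳ-≤ (errorConst p) (ℕP.^-monoˡ-≤ p (ℕP.+-monoˡ-≤ 2 (ℕP.+-monoˡ-≤ β (ℕP.n≤1+n α)))))))
  weighted-error-right p α zero = ℕ.z≤n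
  weighted-error-right p α (suc β) = ℕP.≤-trans (ℕP.≤-reflexive (ℤP.abs-* (+ suc β) (Q (suc (suc p)) (+ α) (+ β) - approx p (+ α) (+ β))))
    (ℕP.*-mono-≤ (ℕP.≤-trans (ℕP.m≤n+m (suc β) α) (ℕP.m≤m+n (α ℕ.+ suc β) 2))
                 (ℕP.≤-trans (error-bound p α β) (ℕP.*-monoʳ-≤ (errorConst p) (ℕP.^-monoˡ-≤ p (ℕP.+-monoˡ-≤ 2 (ℕP.+-monoʳ-≤ α (ℕP.n≤1+n β)))))))

open import Defs
open import Data.Nat as ℕ using (ℕ; zero; suc; _!)
open import Data.Nat.Combinatorics using (_C_)
open import Data.Integer as ℤ using (ℤ; +_)
open import Data.Rational as ℚ using (ℚ; 0ℚ; 1ℚ; _+_; _*_; _-_; -_; _≤_; _<_)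
open import Data.Product using (Σ; _×_; _,_)
open import Data.Vec using (Vec; []; _∷_)
open import Data.Fin.Subset using (Subset; inside; outside; ∣_∣)
import Data.Fin.Subset

open import Data.Bool using (Bool; true; false)
open import Data.List using (List; []; _∷_; map)
open import Data.Empty using (⊥; ⊥-elim)
open import Relation.Binary.PropositionalEquality using (_≡_; refl; sym; trans; cong; cong₂; subst; subst₂; module ≡-Reasoning)
import Data.Nat.Properties as ℕP
import Data.Integer.Properties as ℤP
import Data.Rational.Properties as ℚP
open import Data.Nat.Coprimality using (Coprime)
open import Data.Nat.Divisibility using (∣1⇒≡1)
import Data.Rational.Solver as ℚSolver
import Data.Integer.Solver as ℤSolver
import Data.Nat.Solver as NatSolver
open SignSums using (spin; spinSum; character; signum; linearForm; sumOver; corr; parity; parity-even; parity-odd;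
  sideSign; president-double; corr-empty; binomialPrefix; Q; closedForm; weighted-formula)
open ErrorBound using (triangular; approx; errorConst; error-bound)

module QS = ℚSolver.+-*-Solver
module ZS = ℤSolver.+-*-Solver

-- z / 1 is already in normal form, so ℤ→ℚ is a ring homomorphism and ℕ→ℚ an embedding.
coprime-1 : ∀ n → Coprime n 1
coprime-1 n (_ , d∣1) = ∣1⇒≡1 d∣1

ℤ→ℚ-mkℚ : ∀ z → ℤ→ℚ z ≡ ℚ.mkℚ z 0 (coprime-1 ℤ.∣ z ∣)
ℤ→ℚ-mkℚ (+ n) = ℚP.normalize-coprime (coprime-1 n)
ℤ→ℚ-mkℚ ℤ.-[1+ n ] = cong -_ (ℚP.normalize-coprime (coprime-1 (suc n)))

ℤ→ℚ-+ : ∀ a b → ℤ→ℚ (a ℤ.+ b) ≡ ℤ→ℚ a + ℤ→ℚ b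
ℤ→ℚ-+ a b rewrite ℤ→ℚ-mkℚ a | ℤ→ℚ-mkℚ b =
  sym (cong (ℚ._/ 1) (cong₂ ℤ._+_ (ℤP.*-identityʳ a) (ℤP.*-identityʳ b)))

ℤ→ℚ-* : ∀ a b → ℤ→ℚ (a ℤ.* b) ≡ ℤ→ℚ a * ℤ→ℚ b
ℤ→ℚ-* a b rewrite ℤ→ℚ-mkℚ a | ℤ→ℚ-mkℚ b = refl

ℤ→ℚ-neg : ∀ a → ℤ→ℚ (ℤ.- a) ≡ - ℤ→ℚ a
ℤ→ℚ-neg a rewrite ℤ→ℚ-mkℚ a | ℤ→ℚ-mkℚ (ℤ.- a) = neg-mkℚ a
  where neg-mkℚ : ∀ a → ℚ.mkℚ (ℤ.- a) 0 (coprime-1 ℤ.∣ ℤ.- a ∣) ≡ - ℚ.mkℚ a 0 (coprime-1 ℤ.∣ a ∣)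
        neg-mkℚ (+ zero) = refl
        neg-mkℚ ℤ.+[1+ n ] = refl
        neg-mkℚ ℤ.-[1+ n ] = refl

ℤ→ℚ-- : ∀ a b → ℤ→ℚ (a ℤ.- b) ≡ ℤ→ℚ a - ℤ→ℚ b
ℤ→ℚ-- a b = trans (ℤ→ℚ-+ a (ℤ.- b)) (cong (λ q → ℤ→ℚ a + q) (ℤ→ℚ-neg b))

ℤ→ℚ-^ : ∀ z n → ℤ→ℚ (z ℤ.^ n) ≡ ℤ→ℚ z ^ℕ n
ℤ→ℚ-^ z zero = refl
ℤ→ℚ-^ z (suc n) = trans (ℤ→ℚ-* z (z ℤ.^ n)) (cong (ℤ→ℚ z *_) (ℤ→ℚ-^ z n))

^ℕ-distrib-* : ∀ x y n → (x * y) ^ℕ n ≡ (x ^ℕ n) * (y ^ℕ n)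
^ℕ-distrib-* x y zero = sym (ℚP.*-identityˡ 1ℚ)
^ℕ-distrib-* x y (suc n) = trans (cong ((x * y) *_) (^ℕ-distrib-* x y n))
  (QS.solve 4 (λ x y a b → (x QS.:* y) QS.:* (a QS.:* b) QS.:= (x QS.:* a) QS.:* (y QS.:* b)) refl x y (x ^ℕ n) (y ^ℕ n))

∣ℤ→ℚ∣ : ∀ z → ℚ.∣ ℤ→ℚ z ∣ ≡ ℕ→ℚ ℤ.∣ z ∣
∣ℤ→ℚ∣ z rewrite ℤ→ℚ-mkℚ z | ℤ→ℚ-mkℚ (+ ℤ.∣ z ∣) = refl

ℕ→ℚ-+ : ∀ a b → ℕ→ℚ (a ℕ.+ b) ≡ ℕ→ℚ a + ℕ→ℚ b
ℕ→ℚ-+ a b = ℤ→ℚ-+ (+ a) (+ b)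

ℕ→ℚ-* : ∀ a b → ℕ→ℚ (a ℕ.* b) ≡ ℕ→ℚ a * ℕ→ℚ b
ℕ→ℚ-* a b = trans (cong ℤ→ℚ (ℤP.pos-* a b)) (ℤ→ℚ-* (+ a) (+ b))

ℕ→ℚ-^ : ∀ a n → ℕ→ℚ (a ℕ.^ n) ≡ ℕ→ℚ a ^ℕ n
ℕ→ℚ-^ a zero = refl
ℕ→ℚ-^ a (suc n) = trans (ℕ→ℚ-* a (a ℕ.^ n)) (cong (ℕ→ℚ a *_) (ℕ→ℚ-^ a n))

ℕ→ℚ-injective : ∀ a b → ℕ→ℚ a ≡ ℕ→ℚ b → a ≡ b
ℕ→ℚ-injective a b eq rewrite ℤ→ℚ-mkℚ (+ a) | ℤ→ℚ-mkℚ (+ b) = ℤP.+-injective (cong ℚ.numerator eq)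

ℕ→ℚ-mono-≤ : ∀ a b → a ℕ.≤ b → ℕ→ℚ a ≤ ℕ→ℚ b
ℕ→ℚ-mono-≤ a b a≤b rewrite ℤ→ℚ-mkℚ (+ a) | ℤ→ℚ-mkℚ (+ b) =
  ℚ.*≤* (subst₂ ℤ._≤_ (sym (ℤP.*-identityʳ (+ a))) (sym (ℤP.*-identityʳ (+ b))) (ℤ.+≤+ a≤b))

inv-inverseˡ : ∀ n → 1 ℕ.≤ n → inv (ℕ→ℚ n) * ℕ→ℚ n ≡ 1ℚ
inv-inverseˡ (suc n) _ rewrite ℤ→ℚ-mkℚ (+ suc n) = ℚP.*-inverseˡ (ℚ.mkℚ (+ suc n) 0 (coprime-1 (suc n)))

inv-unique : ∀ n → 1 ℕ.≤ n → ∀ y → ℕ→ℚ n * y ≡ 1ℚ → inv (ℕ→ℚ n) ≡ y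
inv-unique n 1≤n y ny≡1 = begin
  inv (ℕ→ℚ n)                 ≡⟨ sym (ℚP.*-identityʳ (inv (ℕ→ℚ n))) ⟩
  inv (ℕ→ℚ n) * 1ℚ            ≡⟨ cong (inv (ℕ→ℚ n) *_) (sym ny≡1) ⟩
  inv (ℕ→ℚ n) * (ℕ→ℚ n * y)   ≡⟨ sym (ℚP.*-assoc (inv (ℕ→ℚ n)) (ℕ→ℚ n) y) ⟩
  (inv (ℕ→ℚ n) * ℕ→ℚ n) * y   ≡⟨ cong (_* y) (inv-inverseˡ n 1≤n) ⟩
  1ℚ * y                      ≡⟨ ℚP.*-identityˡ y ⟩
  y                           ∎
  where open ≡-Reasoning

sign-ℤ→ℚ : ∀ z → sign (ℤ→ℚ z) ≡ ℤ→ℚ (signum z)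
sign-ℤ→ℚ z rewrite ℤ→ℚ-mkℚ z = sign-mkℚ z
  where sign-mkℚ : ∀ z → sign (ℚ.mkℚ z 0 (coprime-1 ℤ.∣ z ∣)) ≡ ℤ→ℚ (signum z)
        sign-mkℚ (+ zero) = refl
        sign-mkℚ ℤ.+[1+ n ] = refl
        sign-mkℚ ℤ.-[1+ n ] = refl

val-spin : ∀ b → val b ≡ ℤ→ℚ (spin b)
val-spin true = refl
val-spin false = refl

sumVals-spinSum : ∀ {n} (x : Vec Bool n) → sumVals x ≡ ℤ→ℚ (spinSum x)
sumVals-spinSum [] = refl
sumVals-spinSum (b ∷ x) = trans (cong₂ _+_ (val-spin b) (sumVals-spinSum x)) (sym (ℤ→ℚ-+ (spin b) (spinSum x)))

χ-character : ∀ {n} (I : Subset n) x → χ I x ≡ ℤ→ℚ (character I x)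
χ-character [] [] = refl
χ-character (inside ∷ I) (b ∷ x) = trans (cong₂ _*_ (val-spin b) (χ-character I x)) (sym (ℤ→ℚ-* (spin b) (character I x)))
χ-character (outside ∷ I) (b ∷ x) = χ-character I x

linForm-linearForm : ∀ c {k} (x : Vec Bool k) → linForm (ℤ→ℚ c) x ≡ ℤ→ℚ (linearForm c x)
linForm-linearForm c [] = refl
linForm-linearForm c (b ∷ x) = trans (cong₂ _+_ (trans (cong (ℤ→ℚ c *_) (val-spin b)) (sym (ℤ→ℚ-* c (spin b)))) (sumVals-spinSum x))
                                     (sym (ℤ→ℚ-+ (c ℤ.* spin b) (spinSum x)))

sumℚ-sumOver : ∀ {A : Set} (g : A → ℚ) (h : A → ℤ) → (∀ x → g x ≡ ℤ→ℚ (h x)) → ∀ xs → sumℚ (map g xs) ≡ ℤ→ℚ (sumOver h xs)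
sumℚ-sumOver g h g≗h [] = refl
sumℚ-sumOver g h g≗h (x ∷ xs) = trans (cong₂ _+_ (g≗h x) (sumℚ-sumOver g h g≗h xs)) (sym (ℤ→ℚ-+ (h x) (sumOver h xs)))

fourier-integral : ∀ δ k c → δ * ℕ→ℚ k ≡ ℤ→ℚ c → (I : Subset k) →
  fourier k (P δ k) I ≡ inv (ℕ→ℚ (2 ℕ.^ k)) * ℤ→ℚ (sumOver (λ x → signum (linearForm c x) ℤ.* character I x) (allPoints k))
fourier-integral δ k c δk≡c I = cong (inv (ℕ→ℚ (2 ℕ.^ k)) *_) (sumℚ-sumOver _ _ pointwise (allPoints k))
  where pointwise : ∀ x → P δ k x * χ I x ≡ ℤ→ℚ (signum (linearForm c x) ℤ.* character I x)
        pointwise x = trans (cong₂ _*_ (trans (cong (λ q → sign (linForm q x)) δk≡c) (trans (cong sign (linForm-linearForm c x)) (sign-ℤ→ℚ (linearForm c x))))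
                                       (χ-character I x))
                            (sym (ℤ→ℚ-* (signum (linearForm c x)) (character I x)))

u+v≡k : ∀ k δ u v → ℕ→ℚ u ≡ (1ℚ + δ) * ℚ.½ * ℕ→ℚ k → ℕ→ℚ v ≡ (1ℚ - δ) * ℚ.½ * ℕ→ℚ k → u ℕ.+ v ≡ k
u+v≡k k δ u v hu hv = ℕ→ℚ-injective (u ℕ.+ v) k (trans (ℕ→ℚ-+ u v) (trans (cong₂ _+_ hu hv)
  (QS.solve 2 (λ d K → (QS.con 1ℚ QS.:+ d) QS.:* QS.con ℚ.½ QS.:* K QS.:+ (QS.con 1ℚ QS.:- d) QS.:* QS.con ℚ.½ QS.:* K QS.:= K) refl δ (ℕ→ℚ k))))

δk≡u-v : ∀ k δ u v → ℕ→ℚ u ≡ (1ℚ + δ) * ℚ.½ * ℕ→ℚ k → ℕ→ℚ v ≡ (1ℚ - δ) * ℚ.½ * ℕ→ℚ k → δ * ℕ→ℚ k ≡ ℤ→ℚ (+ u ℤ.- + v)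
δk≡u-v k δ u v hu hv = trans
  (QS.solve 2 (λ d K → d QS.:* K QS.:= (QS.con 1ℚ QS.:+ d) QS.:* QS.con ℚ.½ QS.:* K QS.:- (QS.con 1ℚ QS.:- d) QS.:* QS.con ℚ.½ QS.:* K) refl δ (ℕ→ℚ k))
  (trans (cong₂ _-_ (sym hu) (sym hv)) (sym (ℤ→ℚ-- (+ u) (+ v))))

half-k-cancel : ∀ j (x : ℚ) → 0ℚ ≡ x * ℚ.½ * ℕ→ℚ (suc j) → x ≡ 0ℚ
half-k-cancel j x 0≡x½k = begin
  x                          ≡⟨ sym (ℚP.*-identityʳ x) ⟩
  x * 1ℚ                     ≡⟨ cong (x *_) (sym (inv-inverseˡ (suc j) (ℕ.s≤s ℕ.z≤n))) ⟩
  x * (iK * K)               ≡⟨ QS.solve 3 (λ x K i → x QS.:* (i QS.:* K) QS.:= (x QS.:* QS.con ℚ.½ QS.:* K) QS.:* (QS.con (ℕ→ℚ 2) QS.:* i)) refl x K iK ⟩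
  (x * ℚ.½ * K) * (ℕ→ℚ 2 * iK) ≡⟨ cong (_* (ℕ→ℚ 2 * iK)) (sym 0≡x½k) ⟩
  0ℚ * (ℕ→ℚ 2 * iK)          ≡⟨ ℚP.*-zeroˡ (ℕ→ℚ 2 * iK) ⟩
  0ℚ                         ∎
  where open ≡-Reasoning
        K = ℕ→ℚ (suc j)
        iK = inv K

-- The hypotheses on (k, δ, u, v), reparametrized as k = j + 2, u = α + 1, v = β + 1 with α + β = j
-- and δk = α - β (u, v > 0 because -1 < δ < 1): a property proved in these terms holds for (k, δ, u, v).
reparametrize : (F : ℕ → ℚ → ℕ → ℕ → Set) →
  (∀ j α β δ → α ℕ.+ β ≡ j → δ * ℕ→ℚ (suc (suc j)) ≡ ℤ→ℚ (+ α ℤ.- + β) → F (suc (suc j)) δ (suc α) (suc β)) →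
  ∀ k δ u v → 2 ℕ.≤ k → 0ℚ < δ → δ < 1ℚ →
  ℕ→ℚ u ≡ (1ℚ + δ) * ℚ.½ * ℕ→ℚ k → ℕ→ℚ v ≡ (1ℚ - δ) * ℚ.½ * ℕ→ℚ k → F k δ u v
reparametrize F core (suc (suc j)) δ zero v (ℕ.s≤s (ℕ.s≤s ℕ.z≤n)) 0<δ δ<1 hu hv = ⊥-elim (0≮-1 (subst (0ℚ <_) δ≡-1 0<δ))
  where
  0≮-1 : 0ℚ < - 1ℚ → ⊥
  0≮-1 (ℚ.*<* ())
  δ≡-1 : δ ≡ - 1ℚ
  δ≡-1 = trans (QS.solve 1 (λ d → d QS.:= (QS.con 1ℚ QS.:+ d) QS.:- QS.con 1ℚ) refl δ) (cong (_- 1ℚ) (half-k-cancel (suc j) (1ℚ + δ) hu))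
reparametrize F core (suc (suc j)) δ (suc α) zero (ℕ.s≤s (ℕ.s≤s ℕ.z≤n)) 0<δ δ<1 hu hv = ⊥-elim (ℚP.<-irrefl δ≡1 δ<1)
  where
  δ≡1 : δ ≡ 1ℚ
  δ≡1 = trans (QS.solve 1 (λ d → d QS.:= QS.con 1ℚ QS.:- (QS.con 1ℚ QS.:- d)) refl δ) (cong (λ w → 1ℚ - w) (half-k-cancel (suc j) (1ℚ - δ) hv))
reparametrize F core (suc (suc j)) δ (suc α) (suc β) (ℕ.s≤s (ℕ.s≤s ℕ.z≤n)) 0<δ δ<1 hu hv = core j α β δ
  (ℕP.suc-injective (ℕP.suc-injective (trans (cong suc (sym (ℕP.+-suc α β))) (u+v≡k (suc (suc j)) δ (suc α) (suc β) hu hv))))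
  (trans (δk≡u-v (suc (suc j)) δ (suc α) (suc β) hu hv)
         (cong ℤ→ℚ (ZS.solve 2 (λ a b → (ZS.con (+ 1) ZS.:+ a) ZS.:- (ZS.con (+ 1) ZS.:+ b) ZS.:= a ZS.:- b) refl (+ α) (+ β))))

inv-2^-shift : ∀ j → inv (ℕ→ℚ (2 ℕ.^ j)) ≡ inv (ℕ→ℚ (2 ℕ.^ suc (suc j))) * (ℕ→ℚ 2 * ℕ→ℚ 2)
inv-2^-shift j = inv-unique (2 ℕ.^ j) (ℕP.m^n>0 2 j) _ (begin
  ℕ→ℚ (2 ℕ.^ j) * (i * (ℕ→ℚ 2 * ℕ→ℚ 2))
    ≡⟨ QS.solve 3 (λ P i t → P QS.:* (i QS.:* (t QS.:* t)) QS.:= i QS.:* (t QS.:* (t QS.:* P))) refl (ℕ→ℚ (2 ℕ.^ j)) i (ℕ→ℚ 2) ⟩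
  i * (ℕ→ℚ 2 * (ℕ→ℚ 2 * ℕ→ℚ (2 ℕ.^ j)))
    ≡⟨ cong (i *_) (sym (trans (ℕ→ℚ-* 2 (2 ℕ.* 2 ℕ.^ j)) (cong (ℕ→ℚ 2 *_) (ℕ→ℚ-* 2 (2 ℕ.^ j))))) ⟩
  i * ℕ→ℚ (2 ℕ.^ suc (suc j))   ≡⟨ inv-inverseˡ _ (ℕP.m^n>0 2 (suc (suc j))) ⟩
  1ℚ                            ∎)
  where open ≡-Reasoning
        i = inv (ℕ→ℚ (2 ℕ.^ suc (suc j)))

Σ<-binomialPrefix : ∀ m v → Σ< v (λ l → ℕ→ℚ (m C l)) ≡ ℕ→ℚ (binomialPrefix m v)
Σ<-binomialPrefix m zero = refl
Σ<-binomialPrefix m (suc v) = trans (cong (_+ ℕ→ℚ (m C v)) (Σ<-binomialPrefix m v)) (sym (ℕ→ℚ-+ (binomialPrefix m v) (m C v)))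

president-coefficient : ∀ j α β δ → α ℕ.+ β ≡ j → δ * ℕ→ℚ (suc (suc j)) ≡ ℤ→ℚ (+ α ℤ.- + β) →
  (I : Subset (suc (suc j))) → HasPresident I → ∣ I ∣ ≡ 1 →
  fourier (suc (suc j)) (P δ (suc (suc j))) I ≡ 1ℚ - inv (ℕ→ℚ (2 ℕ.^ j)) * Σ< (suc β) (λ l → ℕ→ℚ (suc j C l))
president-coefficient j α β δ α+β≡j δk≡α-β (inside ∷ J) refl ∣I∣≡1 = begin
  fourier k (P δ k) (inside ∷ J)
    ≡⟨ fourier-integral δ k c δk≡α-β (inside ∷ J) ⟩
  i * ℤ→ℚ (sumOver (λ x → signum (linearForm c x) ℤ.* character (inside ∷ J) x) (allPoints k))
    ≡⟨ cong (λ z → i * ℤ→ℚ z) (president-double c inside J (cong parity ∣J∣≡0)) ⟩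
  i * ℤ→ℚ (+ 2 ℤ.* corr c J)
    ≡⟨ cong (λ z → i * ℤ→ℚ (+ 2 ℤ.* corr z J)) c≡u-v ⟩
  i * ℤ→ℚ (+ 2 ℤ.* corr (+ suc α ℤ.- + suc β) J)
    ≡⟨ cong (λ z → i * ℤ→ℚ (+ 2 ℤ.* z)) (corr-empty J (suc α) (suc β) ∣J∣≡0 (cong suc (trans (ℕP.+-suc α β) (cong suc α+β≡j)))) ⟩
  i * ℤ→ℚ (+ 2 ℤ.* (+ (2 ℕ.^ suc j) ℤ.- + 2 ℤ.* + S))
    ≡⟨ cong (i *_) (trans (ℤ→ℚ-* (+ 2) (+ (2 ℕ.^ suc j) ℤ.- + 2 ℤ.* + S)) (cong (ℕ→ℚ 2 *_) (trans (ℤ→ℚ-- (+ (2 ℕ.^ suc j)) (+ 2 ℤ.* + S)) (cong (λ w → ℕ→ℚ (2 ℕ.^ suc j) - w) (ℤ→ℚ-* (+ 2) (+ S)))))) ⟩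
  i * (ℕ→ℚ 2 * (ℕ→ℚ (2 ℕ.^ suc j) - ℕ→ℚ 2 * ℕ→ℚ S))
    ≡⟨ QS.solve 4 (λ i t X S → i QS.:* (t QS.:* (X QS.:- t QS.:* S)) QS.:= i QS.:* (t QS.:* X) QS.:- (i QS.:* (t QS.:* t)) QS.:* S) refl i (ℕ→ℚ 2) (ℕ→ℚ (2 ℕ.^ suc j)) (ℕ→ℚ S) ⟩
  i * (ℕ→ℚ 2 * ℕ→ℚ (2 ℕ.^ suc j)) - (i * (ℕ→ℚ 2 * ℕ→ℚ 2)) * ℕ→ℚ S
    ≡⟨ cong₂ (λ a b → a - b * ℕ→ℚ S) (trans (cong (i *_) (sym (ℕ→ℚ-* 2 (2 ℕ.^ suc j)))) (inv-inverseˡ _ (ℕP.m^n>0 2 k))) (sym (inv-2^-shift j)) ⟩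
  1ℚ - inv (ℕ→ℚ (2 ℕ.^ j)) * ℕ→ℚ S
    ≡⟨ cong (λ z → 1ℚ - inv (ℕ→ℚ (2 ℕ.^ j)) * z) (sym (Σ<-binomialPrefix (suc j) (suc β))) ⟩
  1ℚ - inv (ℕ→ℚ (2 ℕ.^ j)) * Σ< (suc β) (λ l → ℕ→ℚ (suc j C l)) ∎
  where
  open ≡-Reasoning
  k = suc (suc j)
  c = + α ℤ.- + β
  i = inv (ℕ→ℚ (2 ℕ.^ k))
  S = binomialPrefix (suc j) (suc β)
  ∣J∣≡0 = ℕP.suc-injective ∣I∣≡1
  c≡u-v : c ≡ + suc α ℤ.- + suc β
  c≡u-v = ZS.solve 2 (λ a b → a ZS.:- b ZS.:= (ZS.con (+ 1) ZS.:+ a) ZS.:- (ZS.con (+ 1) ZS.:+ b)) refl (+ α) (+ β)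

divide-by : ∀ n x y → 1 ℕ.≤ n → ℕ→ℚ n * x ≡ y → x ≡ inv (ℕ→ℚ n) * y
divide-by n x y 1≤n nx≡y = begin
  x                              ≡⟨ sym (ℚP.*-identityˡ x) ⟩
  1ℚ * x                         ≡⟨ cong (_* x) (sym (inv-inverseˡ n 1≤n)) ⟩
  (inv (ℕ→ℚ n) * ℕ→ℚ n) * x      ≡⟨ ℚP.*-assoc (inv (ℕ→ℚ n)) (ℕ→ℚ n) x ⟩
  inv (ℕ→ℚ n) * (ℕ→ℚ n * x)      ≡⟨ cong (inv (ℕ→ℚ n) *_) nx≡y ⟩
  inv (ℕ→ℚ n) * y                ∎
  where open ≡-Reasoning

citizen-coefficient : ∀ n j α β δ s → α ℕ.+ β ≡ j → δ * ℕ→ℚ (suc (suc j)) ≡ ℤ→ℚ (+ α ℤ.- + β) →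
  (J : Subset (suc j)) → ∣ J ∣ ≡ suc n → n ℕ.≤ j → parity (suc n) ≡ sideSign s →
  fourier (suc (suc j)) (P δ (suc (suc j))) (s ∷ J)
    ≡ ℤ→ℚ (parity n) * (prefactor (suc (suc j)) (suc n) (suc α) (suc β) * ℤ→ℚ (Q n (+ α) (+ β)))
citizen-coefficient n j α β δ s α+β≡j δk≡α-β J ∣J∣≡1+n n≤j parity≡side = begin
  fourier k (P δ k) (s ∷ J)
    ≡⟨ fourier-integral δ k c δk≡α-β (s ∷ J) ⟩
  i * ℤ→ℚ (sumOver (λ x → signum (linearForm c x) ℤ.* character (s ∷ J) x) (allPoints k))
    ≡⟨ cong (λ z → i * ℤ→ℚ z) (president-double c s J (trans (cong parity ∣J∣≡1+n) parity≡side)) ⟩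
  i * ℤ→ℚ (+ 2 ℤ.* corr c J)                  ≡⟨ cong (i *_) (ℤ→ℚ-* (+ 2) (corr c J)) ⟩
  i * (ℕ→ℚ 2 * ℤ→ℚ (corr c J))                ≡⟨ cong (λ z → i * (ℕ→ℚ 2 * z)) corr-quotient ⟩
  i * (ℕ→ℚ 2 * (iD * (σ * (ℕ→ℚ 2 * (ℕ→ℚ (r !) * q)))))
    ≡⟨ QS.solve 6 (λ i t d σ f q → i QS.:* (t QS.:* (d QS.:* (σ QS.:* (t QS.:* (f QS.:* q)))))
                    QS.:= σ QS.:* (((i QS.:* (t QS.:* t)) QS.:* (f QS.:* d)) QS.:* q)) refl i (ℕ→ℚ 2) iD σ (ℕ→ℚ (r !)) q ⟩
  σ * (((i * (ℕ→ℚ 2 * ℕ→ℚ 2)) * (ℕ→ℚ (r !) * iD)) * q)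
    ≡⟨ cong₂ (λ a b → σ * ((a * (ℕ→ℚ (b !) * iD)) * q)) (sym (inv-2^-shift j)) (sym k∸t∸1≡r) ⟩
  σ * (prefactor k (suc n) (suc α) (suc β) * q) ∎
  where
  open ≡-Reasoning
  k = suc (suc j)
  c = + α ℤ.- + β
  i = inv (ℕ→ℚ (2 ℕ.^ k))
  r = j ℕ.∸ n
  D = α ! ℕ.* β !
  iD = inv (ℕ→ℚ D)
  σ = ℤ→ℚ (parity n)
  q = ℤ→ℚ (Q n (+ α) (+ β))
  k∸t∸1≡r : suc j ℕ.∸ n ℕ.∸ 1 ≡ r
  k∸t∸1≡r = cong (ℕ._∸ 1) (ℕP.+-∸-assoc 1 n≤j)
  main-identity : + D ℤ.* corr c J ≡ closedForm n r (+ α) (+ β)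
  main-identity = weighted-formula J n r ∣J∣≡1+n (cong suc (sym (ℕP.m+[n∸m]≡n n≤j))) α β (trans α+β≡j (sym (ℕP.m+[n∸m]≡n n≤j)))
  corr-quotient : ℤ→ℚ (corr c J) ≡ iD * (σ * (ℕ→ℚ 2 * (ℕ→ℚ (r !) * q)))
  corr-quotient = divide-by D _ _ (ℕP.*-mono-≤ (ℕP.1≤n! α) (ℕP.1≤n! β))
    (trans (sym (ℤ→ℚ-* (+ D) (corr c J))) (trans (cong ℤ→ℚ main-identity)
      (trans (ℤ→ℚ-* (parity n) (+ 2 ℤ.* (+ (r !) ℤ.* Q n (+ α) (+ β)))) (cong (σ *_) (trans (ℤ→ℚ-* (+ 2) (+ (r !) ℤ.* Q n (+ α) (+ β))) (cong (ℕ→ℚ 2 *_) (ℤ→ℚ-* (+ (r !)) (Q n (+ α) (+ β)))))))))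

triangular-double : ∀ p → suc (suc p) ℕ.* suc p ≡ 2 ℕ.* triangular p
triangular-double zero = refl
triangular-double (suc p) = trans (NS.solve 1 (λ P → (NS.con 3 NS.:+ P) NS.:* (NS.con 2 NS.:+ P) NS.:= (NS.con 2 NS.:+ P) NS.:* (NS.con 1 NS.:+ P) NS.:+ NS.con 2 NS.:* (NS.con 2 NS.:+ P)) refl p)
  (trans (cong (ℕ._+ 2 ℕ.* suc (suc p)) (triangular-double p)) (sym (ℕP.*-distribˡ-+ 2 (triangular p) (suc (suc p)))))
  where module NS = NatSolver.+-*-Solver

triangular-half : ∀ p → ℤ→ℚ (+ suc (suc p) ℤ.* + suc p) * ℚ.½ ≡ ℕ→ℚ (triangular p)
triangular-half p = begin
  ℤ→ℚ (+ suc (suc p) ℤ.* + suc p) * ℚ.½   ≡⟨ cong (λ z → ℤ→ℚ z * ℚ.½) (sym (ℤP.pos-* (suc (suc p)) (suc p))) ⟩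
  ℕ→ℚ (suc (suc p) ℕ.* suc p) * ℚ.½       ≡⟨ cong (λ z → ℕ→ℚ z * ℚ.½) (triangular-double p) ⟩
  ℕ→ℚ (2 ℕ.* triangular p) * ℚ.½          ≡⟨ cong (_* ℚ.½) (ℕ→ℚ-* 2 (triangular p)) ⟩
  ℕ→ℚ 2 * ℕ→ℚ (triangular p) * ℚ.½       ≡⟨ QS.solve 3 (λ a t h → a QS.:* t QS.:* h QS.:= t QS.:* (a QS.:* h)) refl (ℕ→ℚ 2) (ℕ→ℚ (triangular p)) ℚ.½ ⟩
  ℕ→ℚ (triangular p) * (ℕ→ℚ 2 * ℚ.½)     ≡⟨ ℚP.*-identityʳ (ℕ→ℚ (triangular p)) ⟩
  ℕ→ℚ (triangular p)                      ∎
  where open ≡-Reasoning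

-- For t = p + 3 the paper's main term is the two-term approximation of Q_{p+2}(α, β):
-- δk = α - β and k = α + β + 2.
mainTerm-approx : ∀ p j α β δ → α ℕ.+ β ≡ j → δ * ℕ→ℚ (suc (suc j)) ≡ ℤ→ℚ (+ α ℤ.- + β) →
  mainTerm δ (suc (suc j)) (suc (suc (suc p))) ≡ ℤ→ℚ (approx p (+ α) (+ β))
mainTerm-approx p j α β δ α+β≡j δk≡c = begin
  (δ * (δ * X)) * (K * (K * Y)) - (W * ℚ.½) * X * (K * Y)
    ≡⟨ QS.solve 6 (λ d K X Y W h → (d QS.:* (d QS.:* X)) QS.:* (K QS.:* (K QS.:* Y)) QS.:- (W QS.:* h) QS.:* X QS.:* (K QS.:* Y)
          QS.:= (d QS.:* K) QS.:* ((d QS.:* K) QS.:* (X QS.:* Y)) QS.:- (W QS.:* h) QS.:* (X QS.:* Y) QS.:* K) refl δ K X Y W ℚ.½ ⟩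
  (δ * K) * ((δ * K) * (X * Y)) - (W * ℚ.½) * (X * Y) * K
    ≡⟨ cong₂ (λ z w → z * (z * w) - (W * ℚ.½) * w * K) δk≡c (sym (^ℕ-distrib-* δ K p)) ⟩
  C * (C * (δ * K) ^ℕ p) - (W * ℚ.½) * (δ * K) ^ℕ p * K
    ≡⟨ cong₂ (λ z w → C * (C * z) - w * z * K) (cong (_^ℕ p) δk≡c) (triangular-half p) ⟩
  C * (C * C ^ℕ p) - ℕ→ℚ (triangular p) * C ^ℕ p * K
    ≡⟨ cong₂ (λ z w → z - ℕ→ℚ (triangular p) * w * K) (sym (ℤ→ℚ-^ c (suc (suc p)))) (sym (ℤ→ℚ-^ c p)) ⟩
  ℤ→ℚ (c ℤ.^ suc (suc p)) - ℕ→ℚ (triangular p) * ℤ→ℚ (c ℤ.^ p) * K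
    ≡⟨ cong (λ z → ℤ→ℚ (c ℤ.^ suc (suc p)) - ℕ→ℚ (triangular p) * ℤ→ℚ (c ℤ.^ p) * z) k≡α+β+2 ⟩
  ℤ→ℚ (c ℤ.^ suc (suc p)) - ℤ→ℚ (+ triangular p) * ℤ→ℚ (c ℤ.^ p) * ℤ→ℚ s
    ≡⟨ sym (trans (ℤ→ℚ-- (c ℤ.^ suc (suc p)) _) (cong (λ w → ℤ→ℚ (c ℤ.^ suc (suc p)) - w)
         (trans (ℤ→ℚ-* (+ triangular p ℤ.* c ℤ.^ p) s) (cong (_* ℤ→ℚ s) (ℤ→ℚ-* (+ triangular p) (c ℤ.^ p)))))) ⟩
  ℤ→ℚ (approx p (+ α) (+ β)) ∎
  where
  open ≡-Reasoning
  K = ℕ→ℚ (suc (suc j))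
  X = δ ^ℕ p
  Y = K ^ℕ p
  W = ℤ→ℚ (+ suc (suc p) ℤ.* + suc p)
  c = + α ℤ.- + β
  s = + α ℤ.+ + β ℤ.+ + 2
  C = ℤ→ℚ c
  k≡α+β+2 : K ≡ ℤ→ℚ s
  k≡α+β+2 = cong ℤ→ℚ (cong +_ (sym (trans (cong (ℕ._+ 2) α+β≡j) (ℕP.+-comm j 2))))

-- The constant K_t of the theorem: K_{p+3} bounds the error of the two-term approximation; for
-- t ≤ 2 the main term is exact.
errorConstant : ℕ → ℚ
errorConstant (suc (suc (suc p))) = ℕ→ℚ (errorConst p)
errorConstant _ = 0ℚ

Q-asymptotics : ∀ n j α β δ → α ℕ.+ β ≡ j → δ * ℕ→ℚ (suc (suc j)) ≡ ℤ→ℚ (+ α ℤ.- + β) →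
  Σ ℚ λ R → (mainTerm δ (suc (suc j)) (suc n) + R ≡ ℤ→ℚ (Q n (+ α) (+ β)))
          × (ℚ.∣ R ∣ ≤ errorConstant (suc n) * (ℕ→ℚ (suc (suc j)) ^ℤ (+ suc n ℤ.- + 3)))
Q-asymptotics zero j α β δ _ _ = 0ℚ ,
  QS.solve 2 (λ X Y → QS.con 1ℚ QS.:* QS.con 1ℚ QS.:- (QS.con 0ℚ QS.:* QS.con ℚ.½) QS.:* X QS.:* Y QS.:+ QS.con 0ℚ QS.:= QS.con 1ℚ) refl (inv δ ^ℕ 2) (inv (ℕ→ℚ (suc (suc j))) ^ℕ 1) ,
  ℚP.≤-reflexive (sym (ℚP.*-zeroˡ (ℕ→ℚ (suc (suc j)) ^ℤ (+ 1 ℤ.- + 3))))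
Q-asymptotics (suc zero) j α β δ _ δk≡c = 0ℚ ,
  trans (QS.solve 3 (λ d K X → (d QS.:* QS.con 1ℚ) QS.:* (K QS.:* QS.con 1ℚ) QS.:- (QS.con 0ℚ QS.:* QS.con ℚ.½) QS.:* X QS.:* QS.con 1ℚ QS.:+ QS.con 0ℚ QS.:= d QS.:* K) refl δ (ℕ→ℚ (suc (suc j))) (inv δ ^ℕ 1))
        (trans δk≡c (cong ℤ→ℚ (ZS.solve 2 (λ a b → a ZS.:- b ZS.:= a ZS.:* ZS.con (+ 1) ZS.:- b ZS.:* ZS.con (+ 1)) refl (+ α) (+ β)))) ,
  ℚP.≤-reflexive (sym (ℚP.*-zeroˡ (ℕ→ℚ (suc (suc j)) ^ℤ (+ 2 ℤ.- + 3))))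
Q-asymptotics (suc (suc p)) j α β δ α+β≡j δk≡c = ℤ→ℚ E , main+R≡Q , ∣R∣≤K
  where
  q = Q (suc (suc p)) (+ α) (+ β)
  E = q ℤ.- approx p (+ α) (+ β)
  main+R≡Q : mainTerm δ (suc (suc j)) (suc (suc (suc p))) + ℤ→ℚ E ≡ ℤ→ℚ q
  main+R≡Q = trans (cong₂ _+_ (mainTerm-approx p j α β δ α+β≡j δk≡c) (ℤ→ℚ-- q (approx p (+ α) (+ β))))
    (QS.solve 2 (λ m q → m QS.:+ (q QS.:- m) QS.:= q) refl (ℤ→ℚ (approx p (+ α) (+ β))) (ℤ→ℚ q))
  α+β+2≡k : α ℕ.+ β ℕ.+ 2 ≡ suc (suc j)
  α+β+2≡k = trans (cong (ℕ._+ 2) α+β≡j) (ℕP.+-comm j 2)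
  ∣R∣≤K : ℚ.∣ ℤ→ℚ E ∣ ≤ ℕ→ℚ (errorConst p) * (ℕ→ℚ (suc (suc j)) ^ℕ p)
  ∣R∣≤K = subst₂ _≤_ (sym (∣ℤ→ℚ∣ E))
    (trans (ℕ→ℚ-* (errorConst p) ((α ℕ.+ β ℕ.+ 2) ℕ.^ p)) (cong (ℕ→ℚ (errorConst p) *_) (trans (cong (λ z → ℕ→ℚ (z ℕ.^ p)) α+β+2≡k) (ℕ→ℚ-^ (suc (suc j)) p))))
    (ℕ→ℚ-mono-≤ _ _ (error-bound p α β))

PresidentFormula : ℕ → ℚ → ℕ → ℕ → Set
PresidentFormula k δ u v = (I : Subset k) → HasPresident I → ∣ I ∣ ≡ 1 →
  fourier k (P δ k) I ≡ 1ℚ - inv (ℕ→ℚ (2 ℕ.^ (k ℕ.∸ 2))) * Σ< v (λ l → ℕ→ℚ ((k ℕ.∸ 1) C l))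

OddCitizensFormula : ℚ → ℕ → ℕ → ℚ → ℕ → ℕ → Set
OddCitizensFormula K t k δ u v = (Σ ℕ λ m → t ≡ 2 ℕ.* m ℕ.+ 1) → t ℕ.≤ k ℕ.∸ 1 →
  (I : Subset k) → NoPresident I → ∣ I ∣ ≡ t →
  Σ ℚ λ R → (fourier k (P δ k) I ≡ prefactor k t u v * (mainTerm δ k t + R)) × (ℚ.∣ R ∣ ≤ K * (ℕ→ℚ k ^ℤ (+ t ℤ.- + 3)))

EvenCitizensFormula : ℚ → ℕ → ℕ → ℚ → ℕ → ℕ → Set
EvenCitizensFormula K t k δ u v = (Σ ℕ λ m → t ≡ 2 ℕ.* m) → t ℕ.≤ k ℕ.∸ 1 →
  (I : Subset k) → HasPresident I → ∣ I ∣ ≡ suc t →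
  Σ ℚ λ R → (fourier k (P δ k) I ≡ - (prefactor k t u v * (mainTerm δ k t + R))) × (ℚ.∣ R ∣ ≤ K * (ℕ→ℚ k ^ℤ (+ t ℤ.- + 3)))

citizen-asymptotics : ∀ n j α β δ s → α ℕ.+ β ≡ j → δ * ℕ→ℚ (suc (suc j)) ≡ ℤ→ℚ (+ α ℤ.- + β) →
  (J : Subset (suc j)) → ∣ J ∣ ≡ suc n → n ℕ.≤ j → parity (suc n) ≡ sideSign s →
  Σ ℚ λ R → (fourier (suc (suc j)) (P δ (suc (suc j))) (s ∷ J)
              ≡ ℤ→ℚ (parity n) * (prefactor (suc (suc j)) (suc n) (suc α) (suc β) * (mainTerm δ (suc (suc j)) (suc n) + R)))
          × (ℚ.∣ R ∣ ≤ errorConstant (suc n) * (ℕ→ℚ (suc (suc j)) ^ℤ (+ suc n ℤ.- + 3)))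
citizen-asymptotics n j α β δ s α+β≡j δk≡α-β J ∣J∣≡1+n n≤j parity≡side with Q-asymptotics n j α β δ α+β≡j δk≡α-β
... | R , main+R≡Q , ∣R∣≤K = R ,
  trans (citizen-coefficient n j α β δ s α+β≡j δk≡α-β J ∣J∣≡1+n n≤j parity≡side)
        (cong (λ z → ℤ→ℚ (parity n) * (prefactor (suc (suc j)) (suc n) (suc α) (suc β) * z)) (sym main+R≡Q)) ,
  ∣R∣≤K

parity-pred : ∀ n z → parity (suc n) ≡ ℤ.- z → parity n ≡ z
parity-pred n z parity≡-z = trans (sym (ℤP.neg-involutive (parity n))) (trans (cong ℤ.-_ parity≡-z) (ℤP.neg-involutive z))

-- Odd t, president outside I: the sign (-1)^{t-1} is +1.
odd-citizens : ∀ t j α β δ → α ℕ.+ β ≡ j → δ * ℕ→ℚ (suc (suc j)) ≡ ℤ→ℚ (+ α ℤ.- + β) →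
  OddCitizensFormula (errorConstant t) t (suc (suc j)) δ (suc α) (suc β)
odd-citizens zero j α β δ _ _ (m , 0≡2m+1) = ⊥-elim (ℕP.0≢1+n (trans 0≡2m+1 (ℕP.+-comm (2 ℕ.* m) 1)))
odd-citizens (suc n) j α β δ α+β≡j δk≡α-β (m , 1+n≡2m+1) (ℕ.s≤s n≤j) (outside ∷ J) refl ∣J∣≡1+n =
  let parity-t = trans (cong parity 1+n≡2m+1) (parity-odd m)
      (R , coefficient , ∣R∣≤K) = citizen-asymptotics n j α β δ outside α+β≡j δk≡α-β J ∣J∣≡1+n n≤j parity-t
      X = prefactor (suc (suc j)) (suc n) (suc α) (suc β) * (mainTerm δ (suc (suc j)) (suc n) + R)
  in R , trans coefficient (trans (cong (λ z → ℤ→ℚ z * X) (parity-pred n (+ 1) parity-t)) (ℚP.*-identityˡ X)) , ∣R∣≤K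

-- Even t ≥ 1 (hence t ≥ 2), president inside I: the sign (-1)^{t-1} is -1.
even-citizens : ∀ t → 1 ℕ.≤ t → ∀ j α β δ → α ℕ.+ β ≡ j → δ * ℕ→ℚ (suc (suc j)) ≡ ℤ→ℚ (+ α ℤ.- + β) →
  EvenCitizensFormula (errorConstant t) t (suc (suc j)) δ (suc α) (suc β)
even-citizens (suc n) _ j α β δ α+β≡j δk≡α-β (m , 1+n≡2m) (ℕ.s≤s n≤j) (inside ∷ J) refl ∣I∣≡2+n =
  let parity-t = trans (cong parity 1+n≡2m) (parity-even m)
      (R , coefficient , ∣R∣≤K) = citizen-asymptotics n j α β δ inside α+β≡j δk≡α-β J (ℕP.suc-injective ∣I∣≡2+n) n≤j parity-t
      X = prefactor (suc (suc j)) (suc n) (suc α) (suc β) * (mainTerm δ (suc (suc j)) (suc n) + R)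
  in R , trans coefficient (trans (cong (λ z → ℤ→ℚ z * X) (parity-pred n ℤ.-[1+ 0 ] parity-t))
                                  (QS.solve 1 (λ y → QS.:- QS.con 1ℚ QS.:* y QS.:= QS.:- y) refl X)) , ∣R∣≤K

lemma4p4 : (δ₀ : ℚ) → 0ℚ < δ₀ →
    ((k : ℕ) (δ : ℚ) (u v : ℕ) → 2 ℕ.≤ k → δ₀ ≤ δ → δ < 1ℚ →
      IsOddInteger (δ * ℕ→ℚ k + ℕ→ℚ k - 1ℚ) →
      ℕ→ℚ u ≡ (1ℚ + δ) * ℚ.½ * ℕ→ℚ k → ℕ→ℚ v ≡ (1ℚ - δ) * ℚ.½ * ℕ→ℚ k →
      (I : Subset k) → HasPresident I → Data.Fin.Subset.∣ I ∣ ≡ 1 →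
      fourier k (P δ k) I
        ≡ 1ℚ - inv (ℕ→ℚ (2 ℕ.^ (k ℕ.∸ 2))) * Σ< v (λ l → ℕ→ℚ ((k ℕ.∸ 1) C l)))
    ×
    ((t : ℕ) → 1 ℕ.≤ t → Σ ℚ λ K →
      (k : ℕ) (δ : ℚ) (u v : ℕ) → 2 ℕ.≤ k → δ₀ ≤ δ → δ < 1ℚ →
      IsOddInteger (δ * ℕ→ℚ k + ℕ→ℚ k - 1ℚ) →
      ℕ→ℚ u ≡ (1ℚ + δ) * ℚ.½ * ℕ→ℚ k → ℕ→ℚ v ≡ (1ℚ - δ) * ℚ.½ * ℕ→ℚ k →
      ((Σ ℕ λ m → t ≡ 2 ℕ.* m ℕ.+ 1) → t ℕ.≤ k ℕ.∸ 1 →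
        (I : Subset k) → NoPresident I → Data.Fin.Subset.∣ I ∣ ≡ t →
        Σ ℚ λ R → (fourier k (P δ k) I ≡ prefactor k t u v * (mainTerm δ k t + R))
                  × (ℚ.∣ R ∣ ≤ K * (ℕ→ℚ k ^ℤ (+ t ℤ.- + 3))))
      ×
      ((Σ ℕ λ m → t ≡ 2 ℕ.* m) → t ℕ.≤ k ℕ.∸ 1 →
        (I : Subset k) → HasPresident I → Data.Fin.Subset.∣ I ∣ ≡ suc t →
        Σ ℚ λ R → (fourier k (P δ k) I ≡ - (prefactor k t u v * (mainTerm δ k t + R)))
                  × (ℚ.∣ R ∣ ≤ K * (ℕ→ℚ k ^ℤ (+ t ℤ.- + 3)))))
lemma4p4 δ₀ 0<δ₀ =
  (λ k δ u v 2≤k δ₀≤δ δ<1 _ hu hv →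
     reparametrize PresidentFormula president-coefficient k δ u v 2≤k (positive δ₀≤δ) δ<1 hu hv) ,
  λ t 1≤t → errorConstant t , λ k δ u v 2≤k δ₀≤δ δ<1 _ hu hv →
     reparametrize (OddCitizensFormula (errorConstant t) t) (odd-citizens t) k δ u v 2≤k (positive δ₀≤δ) δ<1 hu hv ,
     reparametrize (EvenCitizensFormula (errorConstant t) t) (even-citizens t 1≤t) k δ u v 2≤k (positive δ₀≤δ) δ<1 hu hv
  where
  -- δ ≥ δ₀ > 0.
  positive : ∀ {δ} → δ₀ ≤ δ → 0ℚ < δ
  positive = ℚP.<-≤-trans 0<δ₀
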